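{- Let $n\ge1$ and $1\le k\le n$. Then in $\mathbb{Z}[t]\otimes\Gamma'$, $$P_k(x|t)^2+(-1)^ke_k(t_1,\dots,t_k)P_k(x|t)+2\sum_{i=1}^{k-1}(-1)^iP_{k-i}^{(k)}(x|t)P_{k+i}^{(k)}(x|t)+(-1)^kP_{2k}^{(k)}(x|t)=0.$$
   Context: $x=(x_1,x_2,\dots)$, $t=(t_1,t_2,\dots)$ indeterminates, $\Gamma'=\mathbb{Z}[P_1(x),P_2(x),\dots]$ (Schur $P$-functions). With $(y|t)^k=(y-t_1)\cdots(y-t_k)$ and strict $\lambda$ of length $\ell\le N$, $P_\lambda(x_1,\dots,x_N|t)=\frac{1}{(N-\ell)!}\sum_{w\in S_N}w\big(\prod_{i=1}^\ell(x_i|t)^{\lambda_i}\prod_{i=1}^\ell\prod_{j=i+1}^N\frac{x_i+x_j}{x_i-x_j}\big)$, and $P_\lambda(x|t)$ is its projective limit over even $N$; $P_k=P_{(k)}$. $P_i^{(k)}(x|t)$ is defined by $1+\sum_{i\ge1}2P_i^{(k)}(x|t)u^i=\prod_{i\ge1}\frac{1+x_iu}{1-x_iu}\prod_{j=1}^k(1-t_ju)$. $e_k$ is the $k$-th elementary symmetric polynomial. -}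

module Defs where

open import Data.Nat as ℕ using (ℕ; zero; suc; _∸_; _≤_)
import Data.Nat.Properties as ℕP
open import Data.Nat using (_!)
open import Data.Fin using (Fin; zero; suc; toℕ; punchIn; inject≤)
open import Data.Fin.Base using (_<_)
open import Data.Vec as Vec using (Vec; lookup; [_])
open import Data.List using (List; []; _∷_; map; foldr; concatMap; upTo; filter)
open import Data.List using () renaming (allFin to allFinL)
open import Data.Rational using (ℚ; 0ℚ; 1ℚ; ½; _+_; _*_; _-_; -_; _÷_; ≢-nonZero)
open import Data.Rational.Properties using (_≟_)
open import Data.Integer using (+_)
open import Data.Rational using (_/_)
open import Relation.Nullary using (yes; no)
open import Data.Fin.Properties using () renaming (_<?_ to _<ᶠ?_)

sumL : List ℚ → ℚ
sumL = foldr _+_ 0ℚ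

prodL : List ℚ → ℚ
prodL = foldr _*_ 1ℚ

fromℕ : ℕ → ℚ
fromℕ n = (+ n) / 1

-- total division on ℚ (a / 0 := 0); only used at nonzero denominators
div : ℚ → ℚ → ℚ
div a b with b ≟ 0ℚ
... | yes _ = 0ℚ
... | no b≢0 = _÷_ a b {{≢-nonZero b≢0}}

pow : ℚ → ℕ → ℚ
pow y zero = 1ℚ
pow y (suc m) = pow y m * y

sgn : ℕ → ℚ
sgn zero = 1ℚ
sgn (suc k) = - sgn k

-- Convention: the sequence t = (t_1, t_2, ...) is a function t : ℕ → ℚ
-- with t_j = t j for j ≥ 1 (the value t 0 is never used).

facPow : (ℕ → ℚ) → ℚ → ℕ → ℚ
facPow t y zero = 1ℚ
facPow t y (suc k) = facPow t y k * (y - t (suc k))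

-- e_d(t_1, ..., t_m)
esym : (ℕ → ℚ) → ℕ → ℕ → ℚ
esym t m zero = 1ℚ
esym t zero (suc d) = 0ℚ
esym t (suc m) (suc d) = esym t m (suc d) + t (suc m) * esym t m d

extend : ∀ {n} → Fin (suc n) → (Fin n → Fin n) → Fin (suc n) → Fin (suc n)
extend i σ zero = i
extend i σ (suc j) = punchIn i (σ j)

perms : (n : ℕ) → List (Fin n → Fin n)
perms zero = (λ j → j) ∷ []
perms (suc n) = concatMap (λ σ → map (λ i → extend i σ) (allFinL (suc n))) (perms n)

above : ∀ {N} → Fin N → List (Fin N)
above {N} i = filter (λ j → i <ᶠ? j) (allFinL N)

PλSummand : ∀ {ℓ N} → ℓ ≤ N → Vec ℕ ℓ → (ℕ → ℚ) → (Fin N → ℚ) → ℚ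
PλSummand {ℓ} {N} ℓ≤N λs t x =
  prodL (map (λ i → facPow t (x (inject≤ i ℓ≤N)) (lookup λs i)) (allFinL ℓ))
  * prodL (map (λ i → let i' = inject≤ i ℓ≤N in
       prodL (map (λ j → div (x i' + x j) (x i' - x j)) (above i'))) (allFinL ℓ))

-- P_λ(x_1, ..., x_N | t) evaluated at x : Fin N → ℚ :
-- 1/(N-ℓ)! ∑_{w ∈ S_N} w(summand),  where (w f)(x_1..x_N) = f(x_{w(1)}, ..., x_{w(N)})
Pλ : ∀ {ℓ} (N : ℕ) → ℓ ≤ N → Vec ℕ ℓ → (ℕ → ℚ) → (Fin N → ℚ) → ℚ
Pλ {ℓ} N ℓ≤N λs t x =
  div (sumL (map (λ w → PλSummand ℓ≤N λs t (λ j → x (w j))) (perms N)))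
      (fromℕ ((N ∸ ℓ) !))

-- P_k(x_1..x_N | t) = P_{(k)}, for N ≥ 1
Pk : (M : ℕ) → ℕ → (ℕ → ℚ) → (Fin (suc M) → ℚ) → ℚ
Pk M k t x = Pλ (suc M) (ℕ.s≤s ℕ.z≤n) [ k ] t x

-- formal power series in u over ℚ, as coefficient sequences
Series : Set
Series = ℕ → ℚ

mulS : Series → Series → Series
mulS f g n = sumL (map (λ a → f a * g (n ∸ a)) (upTo (suc n)))

oneS : Series
oneS zero = 1ℚ
oneS (suc _) = 0ℚ

linS : ℚ → Series
linS c zero = 1ℚ
linS c (suc zero) = c
linS c (suc (suc _)) = 0ℚ

-- 1 / (1 - y u) = ∑_m y^m u^m
geomS : ℚ → Series
geomS y m = pow y m

genS : ∀ {N} → ℕ → (ℕ → ℚ) → (Fin N → ℚ) → Series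
genS {N} k t x =
  mulS (foldr mulS oneS (map (λ i → mulS (linS (x i)) (geomS (x i))) (allFinL N)))
       (foldr mulS oneS (map (λ j → linS (- t j)) (map suc (upTo k))))

-- P^{(k)}_i(x_1..x_N | t): 1 + ∑_{i≥1} 2 P^{(k)}_i u^i = genS k t x   (i ≥ 1)
Pkup : ∀ {N} → ℕ → ℕ → (ℕ → ℚ) → (Fin N → ℚ) → ℚ
Pkup k i t x = ½ * genS k t x i

lhsA7 : (M : ℕ) → ℕ → (ℕ → ℚ) → (Fin (suc M) → ℚ) → ℚ
lhsA7 M k t x =
  Pk M k t x * Pk M k t x
  + sgn k * esym t k k * Pk M k t x
  + fromℕ 2 * sumL (map (λ i → sgn i * Pkup k (k ∸ i) t x * Pkup k (k ℕ.+ i) t x)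
                        (map suc (upTo (k ∸ 1))))
  + sgn k * Pkup k (k ℕ.+ k) t x

-- With N = 2m + 2 variables, let X(u) = ∏ᵢ (1 + xᵢu)/(1 − xᵢu), T(u) = ∏_{j≤k} (1 − tⱼu) and
-- G = X T, so that P^(k)_i = G_i / 2. Symmetrising the defining sum gives
-- P_k(x|t) = ∑ᵢ (xᵢ|t)^k wᵢ with wᵢ = ∏_{j≠i} (xᵢ + xⱼ)/(xᵢ − xⱼ), and (xᵢ|t)^k is the
-- u^k-coefficient of T(u)/(1 − xᵢu). Partial fractions give X(u) = (−1)^N + 2 ∑ᵢ wᵢ/(1 − xᵢu),
-- hence 2 P_k = G_k − T_k with T_k = (−1)^k e_k. Since X(−u) X(u) = 1, the u^{2k}-coefficient of
-- G(−u) G(u) = T(−u) T(u) is (−1)^k T_k²; expanding it as ∑ₐ (−1)^a G_a G_{2k−a} and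
-- substituting G_k = 2 P_k + T_k gives the relation.

module Submission where

module QuadraticRelation where
  open import Defs
  open import Data.Nat as ℕ using (ℕ; zero; suc; _∸_; _≤_; _<_; s≤s; z≤n; _!)
  import Data.Nat.Properties as ℕ
  open import Data.Fin using (Fin; zero; suc; toℕ; punchIn)
  open import Data.Fin.Properties using (toℕ<n; toℕ≤pred[n]; toℕ-inject₁; toℕ-fromℕ; 0≢1+n; suc-injective) renaming (_<?_ to _<ᶠ?_)
  open import Data.Rational using (ℚ; 0ℚ; 1ℚ; ½; _+_; _*_; _-_; -_; ≢-nonZero; toℚᵘ)
  open import Data.Rational.Properties
    using (_≟_; <-irrefl; positive⁻¹; normalize-pos; toℚᵘ-injective; toℚᵘ-fromℚᵘ; toℚᵘ-homo-+;
           +-*-commutativeRing; *-1-commutativeMonoid;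
           +-identityʳ; +-identityˡ; +-assoc; *-zeroʳ; *-zeroˡ; *-comm; *-identityˡ; *-identityʳ; *-inverseʳ; *-assoc)
  open import Data.Rational.Unnormalised as ℚᵘ using (mkℚᵘ; *≡*)
  import Data.Rational.Unnormalised.Properties as ℚᵘ
  import Data.Integer as ℤ
  import Data.Integer.Properties as ℤ
  open import Data.Rational.Solver using (module +-*-Solver)
  open import Data.List using (List; []; _∷_; _++_; _∷ʳ_; map; foldr; applyUpTo; upTo; tabulate; concatMap; length)
    renaming (allFin to allFinL)
  open import Data.List.Relation.Unary.All as All using (All; []; _∷_)
  open import Data.List.Relation.Unary.All.Properties using (map⁺; concat⁺; tabulate⁺)
  open import Data.Vec using ([_])
  import Data.List.Properties as List
  open import Relation.Binary.PropositionalEquality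
    using (_≡_; _≢_; refl; sym; trans; cong; cong₂; _≗_; module ≡-Reasoning)
  open import Relation.Nullary using (yes; no; contradiction)
  open import Function using (_∘_)
  open import Function.Definitions using (Injective)
  open import Algebra.Bundles using (CommutativeRing)
  open import Algebra.Properties.Semiring.Sum (CommutativeRing.semiring +-*-commutativeRing)
    using (sum-syntax; sum-cong-≗; sum-replicate-zero; ∑-distrib-+; ∑-comm; *-distribˡ-sum; sum-init-last)
  open import Algebra.Properties.CommutativeMonoid.Sum *-1-commutativeMonoid
    using () renaming (sum to prod; sum-remove to prod-remove)
  open +-*-Solver

  two : ℚ
  two = 1ℚ + 1ℚ

  sgn-+ : ∀ a b → sgn (a ℕ.+ b) ≡ sgn a * sgn b
  sgn-+ zero    b = sym (*-identityˡ (sgn b))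
  sgn-+ (suc a) b = trans (cong -_ (sgn-+ a b))
    (solve 2 (λ s t → :- (s :* t) := (:- s) :* t) refl (sgn a) (sgn b))

  sgn*sgn≡1 : ∀ n → sgn n * sgn n ≡ 1ℚ
  sgn*sgn≡1 zero    = refl
  sgn*sgn≡1 (suc n) = trans (solve 1 (λ s → (:- s) :* (:- s) := s :* s) refl (sgn n)) (sgn*sgn≡1 n)

  sgn-∸ : ∀ {k j} → j ≤ k → sgn (k ∸ j) ≡ sgn k * sgn j
  sgn-∸ {k} {j} j≤k = sym (begin
    sgn k * sgn j                ≡⟨ cong (λ n → sgn n * sgn j) (sym (ℕ.m∸n+n≡m j≤k)) ⟩
    sgn (k ∸ j ℕ.+ j) * sgn j    ≡⟨ cong (_* sgn j) (sgn-+ (k ∸ j) j) ⟩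
    sgn (k ∸ j) * sgn j * sgn j  ≡⟨ *-assoc (sgn (k ∸ j)) (sgn j) (sgn j) ⟩
    sgn (k ∸ j) * (sgn j * sgn j) ≡⟨ cong (sgn (k ∸ j) *_) (sgn*sgn≡1 j) ⟩
    sgn (k ∸ j) * 1ℚ             ≡⟨ *-identityʳ (sgn (k ∸ j)) ⟩
    sgn (k ∸ j)                  ∎)
    where open ≡-Reasoning

  sgn-even : ∀ m → sgn (2 ℕ.* m) ≡ 1ℚ
  sgn-even m = begin
    sgn (m ℕ.+ (m ℕ.+ 0)) ≡⟨ cong (λ n → sgn (m ℕ.+ n)) (ℕ.+-identityʳ m) ⟩
    sgn (m ℕ.+ m)         ≡⟨ sgn-+ m m ⟩
    sgn m * sgn m         ≡⟨ sgn*sgn≡1 m ⟩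
    1ℚ                    ∎
    where open ≡-Reasoning

  inv : ℚ → ℚ
  inv q = div 1ℚ q

  div≡*inv : ∀ p q → div p q ≡ p * inv q
  div≡*inv p q with q ≟ 0ℚ
  ... | yes _ = sym (*-zeroʳ p)
  ... | no  _ = cong (p *_) (sym (*-identityˡ _))

  *-inv : ∀ {q} → q ≢ 0ℚ → q * inv q ≡ 1ℚ
  *-inv {q} q≢0 with q ≟ 0ℚ
  ... | yes q≡0 = contradiction q≡0 q≢0
  ... | no  q≢0 = trans (cong (q *_) (*-identityˡ _)) (*-inverseʳ q {{≢-nonZero q≢0}})

  ≢⇒-≢0 : ∀ {p q} → p ≢ q → p - q ≢ 0ℚ
  ≢⇒-≢0 {p} {q} p≢q p-q≡0 = p≢q (begin
    p             ≡⟨ solve 2 (λ p q → p := (p :- q) :+ q) refl p q ⟩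
    (p - q) + q   ≡⟨ cong (_+ q) p-q≡0 ⟩
    0ℚ + q        ≡⟨ solve 1 (λ q → con 0ℚ :+ q := q) refl q ⟩
    q             ∎)
    where open ≡-Reasoning

  *-cancelʳ : ∀ {p q} d → d ≢ 0ℚ → p * d ≡ q * d → p ≡ q
  *-cancelʳ {p} {q} d d≢0 pd≡qd = begin
    p                 ≡⟨ solve 1 (λ p → p := p :* con 1ℚ) refl p ⟩
    p * 1ℚ            ≡⟨ cong (p *_) (sym (*-inv d≢0)) ⟩
    p * (d * inv d)   ≡⟨ solve 3 (λ p d e → p :* (d :* e) := (p :* d) :* e) refl p d (inv d) ⟩
    p * d * inv d     ≡⟨ cong (_* inv d) pd≡qd ⟩
    q * d * inv d     ≡⟨ solve 3 (λ q d e → (q :* d) :* e := q :* (d :* e)) refl q d (inv d) ⟩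
    q * (d * inv d)   ≡⟨ cong (q *_) (*-inv d≢0) ⟩
    q * 1ℚ            ≡⟨ *-identityʳ q ⟩
    q                 ∎
    where open ≡-Reasoning

  div-*-cancelˡ : ∀ {c} → c ≢ 0ℚ → ∀ v → div (c * v) c ≡ v
  div-*-cancelˡ {c} c≢0 v = begin
    div (c * v) c        ≡⟨ div≡*inv (c * v) c ⟩
    c * v * inv c        ≡⟨ solve 3 (λ c v i → c :* v :* i := v :* (c :* i)) refl c v (inv c) ⟩
    v * (c * inv c)      ≡⟨ cong (v *_) (*-inv c≢0) ⟩
    v * 1ℚ               ≡⟨ *-identityʳ v ⟩
    v                    ∎
    where open ≡-Reasoning

  inv-swap : ∀ {p q} → p ≢ q → inv (q - p) ≡ - inv (p - q)
  inv-swap {p} {q} p≢q = *-cancelʳ (p - q) (≢⇒-≢0 p≢q) (begin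
    inv (q - p) * (p - q)            ≡⟨ solve 3 (λ p q i → i :* (p :- q) := :- ((q :- p) :* i)) refl p q (inv (q - p)) ⟩
    - ((q - p) * inv (q - p))        ≡⟨ cong -_ (*-inv (≢⇒-≢0 (p≢q ∘ sym))) ⟩
    - 1ℚ                             ≡⟨ cong -_ (*-inv (≢⇒-≢0 p≢q)) ⟨
    - ((p - q) * inv (p - q))        ≡⟨ solve 3 (λ p q i → :- ((p :- q) :* i) := (:- i) :* (p :- q)) refl p q (inv (p - q)) ⟩
    - inv (p - q) * (p - q)          ∎)
    where open ≡-Reasoning

  inv-partialFraction : ∀ {z a y} → z ≢ a → z ≢ y → a ≢ y →
    inv (z - a) * inv (z - y) ≡ (inv (z - a) - inv (z - y)) * inv (a - y)
  inv-partialFraction {z} {a} {y} z≢a z≢y a≢y = *-cancelʳ (a - y) (≢⇒-≢0 a≢y) (begin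
    I * J * (a - y)                          ≡⟨ solve 5 (λ z a y I J → I :* J :* (a :- y) := I :* ((z :- y) :* J) :- J :* ((z :- a) :* I)) refl z a y I J ⟩
    I * ((z - y) * J) - J * ((z - a) * I)    ≡⟨ cong₂ (λ u v → I * u - J * v) (*-inv (≢⇒-≢0 z≢y)) (*-inv (≢⇒-≢0 z≢a)) ⟩
    I * 1ℚ - J * 1ℚ                          ≡⟨ solve 2 (λ I J → I :* con 1ℚ :- J :* con 1ℚ := (I :- J) :* con 1ℚ) refl I J ⟩
    (I - J) * 1ℚ                             ≡⟨ cong ((I - J) *_) (*-inv (≢⇒-≢0 a≢y)) ⟨
    (I - J) * ((a - y) * inv (a - y))        ≡⟨ solve 4 (λ d I J K → (I :- J) :* (d :* K) := (I :- J) :* K :* d) refl (a - y) I J (inv (a - y)) ⟩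
    (I - J) * inv (a - y) * (a - y)          ∎)
    where
    open ≡-Reasoning
    I = inv (z - a)
    J = inv (z - y)

  fromℕ≢0 : ∀ n .{{_ : ℕ.NonZero n}} → fromℕ n ≢ 0ℚ
  fromℕ≢0 n eq = <-irrefl (sym eq) (positive⁻¹ (fromℕ n) {{normalize-pos n 1}})

  fromℕ-suc : ∀ n → fromℕ (suc n) ≡ 1ℚ + fromℕ n
  fromℕ-suc n = toℚᵘ-injective (begin
    toℚᵘ (fromℕ (suc n))                ≈⟨ toℚᵘ-fromℚᵘ (mkℚᵘ (ℤ.+ suc n) 0) ⟩
    mkℚᵘ (ℤ.+ suc n) 0                  ≈⟨ *≡* numerators ⟩
    toℚᵘ 1ℚ ℚᵘ.+ mkℚᵘ (ℤ.+ n) 0           ≈⟨ ℚᵘ.+-congʳ (toℚᵘ 1ℚ) (ℚᵘ.≃-sym (toℚᵘ-fromℚᵘ (mkℚᵘ (ℤ.+ n) 0))) ⟩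
    toℚᵘ 1ℚ ℚᵘ.+ toℚᵘ (fromℕ n)         ≈⟨ ℚᵘ.≃-sym (toℚᵘ-homo-+ 1ℚ (fromℕ n)) ⟩
    toℚᵘ (1ℚ + fromℕ n)                 ∎)
    where
    open import Relation.Binary.Reasoning.Setoid ℚᵘ.≃-setoid
    numerators : ℤ.+ suc n ℤ.* ℤ.1ℤ ≡ ℚᵘ.↥ (toℚᵘ 1ℚ ℚᵘ.+ mkℚᵘ (ℤ.+ n) 0) ℤ.* ℤ.1ℤ
    numerators = trans (ℤ.*-identityʳ (ℤ.+ suc n))
      (sym (trans (ℤ.*-identityʳ _) (cong (ℤ._+_ ℤ.1ℤ) (ℤ.*-identityʳ (ℤ.+ n)))))

  sumUpTo : ℕ → (ℕ → ℚ) → ℚ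
  sumUpTo n f = ∑[ i < n ] f (toℕ i)

  sumL-applyUpTo : ∀ n f → sumL (applyUpTo f n) ≡ sumUpTo n f
  sumL-applyUpTo zero    f = refl
  sumL-applyUpTo (suc n) f = cong (f 0 +_) (sumL-applyUpTo n (f ∘ suc))

  sumL-map-upTo : ∀ n f → sumL (map f (upTo n)) ≡ sumUpTo n f
  sumL-map-upTo n f = trans (cong sumL (List.map-applyUpTo (λ i → i) f n)) (sumL-applyUpTo n f)

  ∑-*ˡ : ∀ {n} c (f : Fin n → ℚ) → ∑[ i < n ] (c * f i) ≡ c * ∑[ i < n ] f i
  ∑-*ˡ {n} c f = sym (*-distribˡ-sum {n} c f)

  sumUpTo-snoc : ∀ n f → sumUpTo (suc n) f ≡ sumUpTo n f + f n
  sumUpTo-snoc n f = trans (sum-init-last {n} (f ∘ toℕ))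
    (cong₂ _+_ (sum-cong-≗ {n} (λ i → cong f (toℕ-inject₁ i))) (cong f (toℕ-fromℕ n)))

  sumUpTo-cong< : ∀ n {f g} → (∀ j → j < n → f j ≡ g j) → sumUpTo n f ≡ sumUpTo n g
  sumUpTo-cong< n f≡g = sum-cong-≗ {n} (λ i → f≡g (toℕ i) (toℕ<n i))

  sumUpTo-middle : ∀ k φ → sumUpTo (suc (k ℕ.+ k)) φ ≡ φ k + sumUpTo k (λ j → φ (k ∸ suc j) + φ (k ℕ.+ suc j))
  sumUpTo-middle zero    φ = refl
  sumUpTo-middle (suc k) φ = begin
    sumUpTo (suc (suc k ℕ.+ suc k)) φ
      ≡⟨ cong (λ n → sumUpTo (suc (suc n)) φ) (ℕ.+-suc k k) ⟩
    φ 0 + sumUpTo (suc (suc (k ℕ.+ k))) ψ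
      ≡⟨ cong (φ 0 +_) (sumUpTo-snoc (suc (k ℕ.+ k)) ψ) ⟩
    φ 0 + (sumUpTo (suc (k ℕ.+ k)) ψ + φ (suc (suc (k ℕ.+ k))))
      ≡⟨ cong (λ v → φ 0 + (v + φ (suc (suc (k ℕ.+ k))))) (sumUpTo-middle k ψ) ⟩
    φ 0 + ((ψ k + sumUpTo k (λ j → ψ (k ∸ suc j) + ψ (k ℕ.+ suc j))) + φ (suc (suc (k ℕ.+ k))))
      ≡⟨ cong (λ v → φ 0 + ((ψ k + v) + φ (suc (suc (k ℕ.+ k))))) (sumUpTo-cong< k (λ j j<k → cong (λ i → φ i + ψ (k ℕ.+ suc j)) (sym (ℕ.+-∸-assoc 1 j<k)))) ⟩
    φ 0 + ((φ (suc k) + S) + φ (suc (suc (k ℕ.+ k))))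
      ≡⟨ solve 4 (λ a b c d → a :+ ((b :+ c) :+ d) := b :+ (c :+ (a :+ d))) refl (φ 0) (φ (suc k)) S (φ (suc (suc (k ℕ.+ k)))) ⟩
    φ (suc k) + (S + (φ 0 + φ (suc (suc (k ℕ.+ k)))))
      ≡⟨ cong₂ (λ u v → φ (suc k) + (S + (φ u + φ v))) (sym (ℕ.n∸n≡0 k)) (cong suc (sym (ℕ.+-suc k k))) ⟩
    φ (suc k) + (S + (φ (suc k ∸ suc k) + φ (suc k ℕ.+ suc k)))
      ≡⟨ cong (φ (suc k) +_) (sumUpTo-snoc k (λ j → φ (suc k ∸ suc j) + φ (suc k ℕ.+ suc j))) ⟨
    φ (suc k) + sumUpTo (suc k) (λ j → φ (suc k ∸ suc j) + φ (suc k ℕ.+ suc j))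
      ∎
    where
    open ≡-Reasoning
    ψ = φ ∘ suc
    S = sumUpTo k (λ j → φ (suc k ∸ suc j) + φ (suc k ℕ.+ suc j))

  sumL-++ : ∀ xs ys → sumL (xs ++ ys) ≡ sumL xs + sumL ys
  sumL-++ []       ys = sym (+-identityˡ (sumL ys))
  sumL-++ (x ∷ xs) ys = trans (cong (x +_) (sumL-++ xs ys)) (sym (+-assoc x (sumL xs) (sumL ys)))

  sumL-tabulate : ∀ {n} (f : Fin n → ℚ) → sumL (tabulate f) ≡ ∑[ i < n ] f i
  sumL-tabulate {zero}  f = refl
  sumL-tabulate {suc n} f = cong (f zero +_) (sumL-tabulate (f ∘ suc))

  prodL-tabulate : ∀ {n} (f : Fin n → ℚ) → prodL (tabulate f) ≡ prod f
  prodL-tabulate {zero}  f = refl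
  prodL-tabulate {suc n} f = cong (f zero *_) (prodL-tabulate (f ∘ suc))

  -- Formal power series
  mulS-sum : ∀ f g n → mulS f g n ≡ sumUpTo (suc n) (λ a → f a * g (n ∸ a))
  mulS-sum f g n = sumL-map-upTo (suc n) (λ a → f a * g (n ∸ a))

  mulS-0 : ∀ f g → mulS f g 0 ≡ f 0 * g 0
  mulS-0 f g = trans (mulS-sum f g 0) (+-identityʳ (f 0 * g 0))

  mulS-suc : ∀ f g n → mulS f g (suc n) ≡ f 0 * g (suc n) + mulS (f ∘ suc) g n
  mulS-suc f g n = trans (mulS-sum f g (suc n)) (cong (f 0 * g (suc n) +_) (sym (mulS-sum (f ∘ suc) g n)))

  mulS-cong : ∀ {f f′ g g′} → f ≗ f′ → g ≗ g′ → mulS f g ≗ mulS f′ g′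
  mulS-cong {f} {f′} {g} {g′} f≗f′ g≗g′ n = begin
    mulS f g n                                  ≡⟨ mulS-sum f g n ⟩
    sumUpTo (suc n) (λ a → f a * g (n ∸ a))     ≡⟨ sum-cong-≗ {suc n} (λ i → cong₂ _*_ (f≗f′ (toℕ i)) (g≗g′ (n ∸ toℕ i))) ⟩
    sumUpTo (suc n) (λ a → f′ a * g′ (n ∸ a))   ≡⟨ mulS-sum f′ g′ n ⟨
    mulS f′ g′ n                                ∎
    where open ≡-Reasoning

  mulS-congˡ : ∀ {f f′} g → f ≗ f′ → mulS f g ≗ mulS f′ g
  mulS-congˡ g f≗f′ = mulS-cong {g = g} {g′ = g} f≗f′ (λ _ → refl)

  mulS-congʳ : ∀ f {g g′} → g ≗ g′ → mulS f g ≗ mulS f g′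
  mulS-congʳ f g≗g′ = mulS-cong {f = f} {f′ = f} (λ _ → refl) g≗g′

  mulS-*ʳ : ∀ c f g n → mulS f (λ a → c * g a) n ≡ c * mulS f g n
  mulS-*ʳ c f g n = begin
    mulS f (λ a → c * g a) n                          ≡⟨ mulS-sum f (λ a → c * g a) n ⟩
    sumUpTo (suc n) (λ a → f a * (c * g (n ∸ a)))     ≡⟨ sum-cong-≗ {suc n} (λ i → solve 3 (λ c x y → x :* (c :* y) := c :* (x :* y)) refl c (f (toℕ i)) (g (n ∸ toℕ i))) ⟩
    sumUpTo (suc n) (λ a → c * (f a * g (n ∸ a)))     ≡⟨ ∑-*ˡ {suc n} c (λ i → f (toℕ i) * g (n ∸ toℕ i)) ⟩
    c * sumUpTo (suc n) (λ a → f a * g (n ∸ a))       ≡⟨ cong (c *_) (mulS-sum f g n) ⟨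
    c * mulS f g n                                    ∎
    where open ≡-Reasoning

  mulS-+ʳ : ∀ f g h n → mulS f (λ a → g a + h a) n ≡ mulS f g n + mulS f h n
  mulS-+ʳ f g h n = begin
    mulS f (λ a → g a + h a) n                                      ≡⟨ mulS-sum f (λ a → g a + h a) n ⟩
    sumUpTo (suc n) (λ a → f a * (g (n ∸ a) + h (n ∸ a)))           ≡⟨ sum-cong-≗ {suc n} (λ i → solve 3 (λ x y z → x :* (y :+ z) := x :* y :+ x :* z) refl (f (toℕ i)) (g (n ∸ toℕ i)) (h (n ∸ toℕ i))) ⟩
    sumUpTo (suc n) (λ a → f a * g (n ∸ a) + f a * h (n ∸ a))       ≡⟨ ∑-distrib-+ {suc n} (λ i → f (toℕ i) * g (n ∸ toℕ i)) (λ i → f (toℕ i) * h (n ∸ toℕ i)) ⟩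
    sumUpTo (suc n) (λ a → f a * g (n ∸ a)) + sumUpTo (suc n) (λ a → f a * h (n ∸ a))
                                                                    ≡⟨ cong₂ _+_ (mulS-sum f g n) (mulS-sum f h n) ⟨
    mulS f g n + mulS f h n                                         ∎
    where open ≡-Reasoning

  mulS-∑ʳ : ∀ {k} f (G : Fin k → Series) n → mulS f (λ m → ∑[ i < k ] G i m) n ≡ ∑[ i < k ] mulS f (G i) n
  mulS-∑ʳ {k} f G n = begin
    mulS f (λ m → ∑[ i < k ] G i m) n                               ≡⟨ mulS-sum f (λ m → ∑[ i < k ] G i m) n ⟩
    ∑[ a < suc n ] (f (toℕ a) * ∑[ i < k ] G i (n ∸ toℕ a))          ≡⟨ sum-cong-≗ {suc n} (λ a → *-distribˡ-sum {k} (f (toℕ a)) (λ i → G i (n ∸ toℕ a))) ⟩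
    ∑[ a < suc n ] ∑[ i < k ] (f (toℕ a) * G i (n ∸ toℕ a))          ≡⟨ ∑-comm {suc n} {k} (λ a i → f (toℕ a) * G i (n ∸ toℕ a)) ⟩
    ∑[ i < k ] ∑[ a < suc n ] (f (toℕ a) * G i (n ∸ toℕ a))          ≡⟨ sum-cong-≗ {k} (λ i → mulS-sum f (G i) n) ⟨
    ∑[ i < k ] mulS f (G i) n                                        ∎
    where open ≡-Reasoning

  mulS-comm : ∀ f g → mulS f g ≗ mulS g f
  mulS-comm f g zero = begin
    mulS f g 0  ≡⟨ mulS-0 f g ⟩
    f 0 * g 0   ≡⟨ *-comm (f 0) (g 0) ⟩
    g 0 * f 0   ≡⟨ mulS-0 g f ⟨
    mulS g f 0  ∎
    where open ≡-Reasoning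
  mulS-comm f g (suc zero) = begin
    mulS f g 1                  ≡⟨ mulS-suc f g 0 ⟩
    f 0 * g 1 + mulS f′ g 0     ≡⟨ cong (f 0 * g 1 +_) (mulS-0 f′ g) ⟩
    f 0 * g 1 + f 1 * g 0       ≡⟨ solve 4 (λ a b c d → a :* b :+ c :* d := d :* c :+ b :* a) refl (f 0) (g 1) (f 1) (g 0) ⟩
    g 0 * f 1 + g 1 * f 0       ≡⟨ cong (g 0 * f 1 +_) (mulS-0 g′ f) ⟨
    g 0 * f 1 + mulS g′ f 0     ≡⟨ mulS-suc g f 0 ⟨
    mulS g f 1                  ∎
    where
    open ≡-Reasoning
    f′ = f ∘ suc
    g′ = g ∘ suc
  mulS-comm f g (suc (suc n)) = begin
    mulS f g (suc (suc n))       ≡⟨ mulS-suc f g (suc n) ⟩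
    A + mulS f′ g (suc n)        ≡⟨ cong (A +_) (mulS-comm f′ g (suc n)) ⟩
    A + mulS g f′ (suc n)        ≡⟨ cong (A +_) (mulS-suc g f′ n) ⟩
    A + (B + mulS g′ f′ n)       ≡⟨ cong (λ z → A + (B + z)) (mulS-comm g′ f′ n) ⟩
    A + (B + mulS f′ g′ n)       ≡⟨ solve 3 (λ a b d → a :+ (b :+ d) := b :+ (a :+ d)) refl A B (mulS f′ g′ n) ⟩
    B + (A + mulS f′ g′ n)       ≡⟨ cong (B +_) (mulS-suc f g′ n) ⟨
    B + mulS f g′ (suc n)        ≡⟨ cong (B +_) (mulS-comm f g′ (suc n)) ⟩
    B + mulS g′ f (suc n)        ≡⟨ mulS-suc g f (suc n) ⟨
    mulS g f (suc (suc n))       ∎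
    where
    open ≡-Reasoning
    f′ = f ∘ suc
    g′ = g ∘ suc
    A = f 0 * g (suc (suc n))
    B = g 0 * f (suc (suc n))

  mulS-*ˡ : ∀ c f g n → mulS (λ a → c * f a) g n ≡ c * mulS f g n
  mulS-*ˡ c f g n = begin
    mulS (λ a → c * f a) g n   ≡⟨ mulS-comm (λ a → c * f a) g n ⟩
    mulS g (λ a → c * f a) n   ≡⟨ mulS-*ʳ c g f n ⟩
    c * mulS g f n             ≡⟨ cong (c *_) (mulS-comm g f n) ⟩
    c * mulS f g n             ∎
    where open ≡-Reasoning

  mulS-+ˡ : ∀ f g h n → mulS (λ a → f a + g a) h n ≡ mulS f h n + mulS g h n
  mulS-+ˡ f g h n = begin
    mulS (λ a → f a + g a) h n   ≡⟨ mulS-comm (λ a → f a + g a) h n ⟩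
    mulS h (λ a → f a + g a) n   ≡⟨ mulS-+ʳ h f g n ⟩
    mulS h f n + mulS h g n      ≡⟨ cong₂ _+_ (mulS-comm h f n) (mulS-comm h g n) ⟩
    mulS f h n + mulS g h n      ∎
    where open ≡-Reasoning

  mulS-zeroˡ : ∀ {f} g → (∀ a → f a ≡ 0ℚ) → ∀ n → mulS f g n ≡ 0ℚ
  mulS-zeroˡ {f} g f≡0 n = begin
    mulS f g n                                ≡⟨ mulS-sum f g n ⟩
    sumUpTo (suc n) (λ a → f a * g (n ∸ a))   ≡⟨ sum-cong-≗ {suc n} (λ i → trans (cong (_* g (n ∸ toℕ i)) (f≡0 (toℕ i))) (*-zeroˡ (g (n ∸ toℕ i)))) ⟩
    ∑[ i < suc n ] 0ℚ                          ≡⟨ sum-replicate-zero (suc n) ⟩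
    0ℚ                                        ∎
    where open ≡-Reasoning

  mulS-identityˡ : ∀ g → mulS oneS g ≗ g
  mulS-identityˡ g zero    = trans (mulS-0 oneS g) (*-identityˡ (g 0))
  mulS-identityˡ g (suc n) = begin
    mulS oneS g (suc n)                        ≡⟨ mulS-suc oneS g n ⟩
    1ℚ * g (suc n) + mulS (oneS ∘ suc) g n     ≡⟨ cong₂ _+_ (*-identityˡ (g (suc n))) (mulS-zeroˡ g (λ _ → refl) n) ⟩
    g (suc n) + 0ℚ                             ≡⟨ +-identityʳ (g (suc n)) ⟩
    g (suc n)                                  ∎
    where open ≡-Reasoning

  mulS-identityʳ : ∀ g → mulS g oneS ≗ g
  mulS-identityʳ g n = trans (mulS-comm g oneS n) (mulS-identityˡ g n)

  mulS-assoc : ∀ f g h → mulS (mulS f g) h ≗ mulS f (mulS g h)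
  mulS-assoc f g h zero = begin
    mulS (mulS f g) h 0     ≡⟨ mulS-0 (mulS f g) h ⟩
    mulS f g 0 * h 0        ≡⟨ cong (_* h 0) (mulS-0 f g) ⟩
    f 0 * g 0 * h 0         ≡⟨ *-assoc (f 0) (g 0) (h 0) ⟩
    f 0 * (g 0 * h 0)       ≡⟨ cong (f 0 *_) (mulS-0 g h) ⟨
    f 0 * mulS g h 0        ≡⟨ mulS-0 f (mulS g h) ⟨
    mulS f (mulS g h) 0     ∎
    where open ≡-Reasoning
  mulS-assoc f g h (suc n) = begin
    mulS (mulS f g) h (suc n)
      ≡⟨ mulS-suc (mulS f g) h n ⟩
    mulS f g 0 * h (suc n) + mulS (mulS f g ∘ suc) h n
      ≡⟨ cong₂ _+_ (cong (_* h (suc n)) (mulS-0 f g)) (mulS-congˡ h (mulS-suc f g) n) ⟩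
    f 0 * g 0 * h (suc n) + mulS (λ a → f 0 * g (suc a) + mulS f′ g a) h n
      ≡⟨ cong (f 0 * g 0 * h (suc n) +_) (mulS-+ˡ (λ a → f 0 * g (suc a)) (mulS f′ g) h n) ⟩
    f 0 * g 0 * h (suc n) + (mulS (λ a → f 0 * g (suc a)) h n + mulS (mulS f′ g) h n)
      ≡⟨ cong₂ (λ u v → f 0 * g 0 * h (suc n) + (u + v)) (mulS-*ˡ (f 0) g′ h n) (mulS-assoc f′ g h n) ⟩
    f 0 * g 0 * h (suc n) + (f 0 * mulS g′ h n + mulS f′ (mulS g h) n)
      ≡⟨ solve 5 (λ a b c d e → a :* b :* c :+ (a :* d :+ e) := a :* (b :* c :+ d) :+ e) refl
           (f 0) (g 0) (h (suc n)) (mulS g′ h n) (mulS f′ (mulS g h) n) ⟩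
    f 0 * (g 0 * h (suc n) + mulS g′ h n) + mulS f′ (mulS g h) n
      ≡⟨ cong (λ z → f 0 * z + mulS f′ (mulS g h) n) (mulS-suc g h n) ⟨
    f 0 * mulS g h (suc n) + mulS f′ (mulS g h) n
      ≡⟨ mulS-suc f (mulS g h) n ⟨
    mulS f (mulS g h) (suc n) ∎
    where
    open ≡-Reasoning
    f′ = f ∘ suc
    g′ = g ∘ suc

  mulS-interchange : ∀ f g h k → mulS (mulS f g) (mulS h k) ≗ mulS (mulS f h) (mulS g k)
  mulS-interchange f g h k n = begin
    mulS (mulS f g) (mulS h k) n     ≡⟨ mulS-assoc f g (mulS h k) n ⟩
    mulS f (mulS g (mulS h k)) n     ≡⟨ mulS-congʳ f (λ m → sym (mulS-assoc g h k m)) n ⟩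
    mulS f (mulS (mulS g h) k) n     ≡⟨ mulS-congʳ f (mulS-congˡ k (mulS-comm g h)) n ⟩
    mulS f (mulS (mulS h g) k) n     ≡⟨ mulS-congʳ f (mulS-assoc h g k) n ⟩
    mulS f (mulS h (mulS g k)) n     ≡⟨ mulS-assoc f h (mulS g k) n ⟨
    mulS (mulS f h) (mulS g k) n     ∎
    where open ≡-Reasoning

  mulS-linS-0 : ∀ c g → mulS (linS c) g 0 ≡ g 0
  mulS-linS-0 c g = trans (mulS-0 (linS c) g) (*-identityˡ (g 0))

  mulS-linS-suc : ∀ c g n → mulS (linS c) g (suc n) ≡ g (suc n) + c * g n
  mulS-linS-suc c g n = trans (mulS-suc (linS c) g n) (cong₂ _+_ (*-identityˡ (g (suc n))) (tail-term n))
    where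
    tail-term : ∀ n → mulS (linS c ∘ suc) g n ≡ c * g n
    tail-term zero    = mulS-0 (linS c ∘ suc) g
    tail-term (suc n) = begin
      mulS (linS c ∘ suc) g (suc n)                        ≡⟨ mulS-suc (linS c ∘ suc) g n ⟩
      c * g (suc n) + mulS (λ a → linS c (suc (suc a))) g n ≡⟨ cong (c * g (suc n) +_) (mulS-zeroˡ g (λ _ → refl) n) ⟩
      c * g (suc n) + 0ℚ                                   ≡⟨ +-identityʳ (c * g (suc n)) ⟩
      c * g (suc n)                                        ∎
      where open ≡-Reasoning

  mulS-geomS-suc : ∀ y g n → mulS (geomS y) g (suc n) ≡ g (suc n) + y * mulS (geomS y) g n
  mulS-geomS-suc y g n = begin
    mulS (geomS y) g (suc n)                            ≡⟨ mulS-suc (geomS y) g n ⟩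
    1ℚ * g (suc n) + mulS (λ a → pow y a * y) g n       ≡⟨ cong₂ _+_ (*-identityˡ (g (suc n))) (mulS-congˡ g (λ a → *-comm (pow y a) y) n) ⟩
    g (suc n) + mulS (λ a → y * pow y a) g n            ≡⟨ cong (g (suc n) +_) (mulS-*ˡ y (geomS y) g n) ⟩
    g (suc n) + y * mulS (geomS y) g n                  ∎
    where open ≡-Reasoning

  foldr-mulS : ∀ (fs : List Series) e → foldr mulS e fs ≗ mulS (foldr mulS oneS fs) e
  foldr-mulS []       e n = sym (mulS-identityˡ e n)
  foldr-mulS (f ∷ fs) e n = begin
    mulS f (foldr mulS e fs) n                ≡⟨ mulS-congʳ f (foldr-mulS fs e) n ⟩
    mulS f (mulS (foldr mulS oneS fs) e) n    ≡⟨ mulS-assoc f (foldr mulS oneS fs) e n ⟨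
    mulS (mulS f (foldr mulS oneS fs)) e n    ∎
    where open ≡-Reasoning

  DegreeAtMost : ℕ → Series → Set
  DegreeAtMost p f = ∀ a → f (suc (p ℕ.+ a)) ≡ 0ℚ

  DegreeAtMost-suc : ∀ {k} f → DegreeAtMost k f → DegreeAtMost (suc k) f
  DegreeAtMost-suc {k} f f≤k a = trans (cong f (cong suc (sym (ℕ.+-suc k a)))) (f≤k (suc a))

  DegreeAtMost⇒next≡0 : ∀ {k} f → DegreeAtMost k f → f (suc k) ≡ 0ℚ
  DegreeAtMost⇒next≡0 {k} f f≤k = trans (cong f (cong suc (sym (ℕ.+-identityʳ k)))) (f≤k 0)

  mulS-top : ∀ p q {f g} → DegreeAtMost p f → DegreeAtMost q g → mulS f g (p ℕ.+ q) ≡ f p * g q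
  mulS-top zero    zero    {f} {g} _   _   = mulS-0 f g
  mulS-top zero    (suc q) {f} {g} f≤0 _   = begin
    mulS f g (suc q)                   ≡⟨ mulS-suc f g q ⟩
    f 0 * g (suc q) + mulS (f ∘ suc) g q ≡⟨ cong (f 0 * g (suc q) +_) (mulS-zeroˡ g f≤0 q) ⟩
    f 0 * g (suc q) + 0ℚ               ≡⟨ +-identityʳ (f 0 * g (suc q)) ⟩
    f 0 * g (suc q)                    ∎
    where open ≡-Reasoning
  mulS-top (suc p) q       {f} {g} f≤p g≤q = begin
    mulS f g (suc (p ℕ.+ q))                                  ≡⟨ mulS-suc f g (p ℕ.+ q) ⟩
    f 0 * g (suc (p ℕ.+ q)) + mulS (f ∘ suc) g (p ℕ.+ q)      ≡⟨ cong₂ _+_ (cong (f 0 *_) g-vanishes) (mulS-top p q {f ∘ suc} {g} f≤p g≤q) ⟩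
    f 0 * 0ℚ + f (suc p) * g q                                ≡⟨ solve 3 (λ a b c → a :* con 0ℚ :+ b :* c := b :* c) refl (f 0) (f (suc p)) (g q) ⟩
    f (suc p) * g q                                           ∎
    where
    open ≡-Reasoning
    g-vanishes : g (suc (p ℕ.+ q)) ≡ 0ℚ
    g-vanishes = trans (cong (g ∘ suc) (ℕ.+-comm p q)) (g≤q p)

  reflectS : Series → Series
  reflectS f a = sgn a * f a

  reflectS-mulS : ∀ f g → reflectS (mulS f g) ≗ mulS (reflectS f) (reflectS g)
  reflectS-mulS f g n = begin
    sgn n * mulS f g n                                          ≡⟨ cong (sgn n *_) (mulS-sum f g n) ⟩
    sgn n * sumUpTo (suc n) (λ a → f a * g (n ∸ a))             ≡⟨ ∑-*ˡ {suc n} (sgn n) (λ i → f (toℕ i) * g (n ∸ toℕ i)) ⟨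
    sumUpTo (suc n) (λ a → sgn n * (f a * g (n ∸ a)))           ≡⟨ sum-cong-≗ {suc n} (λ i → term (toℕ i) (toℕ≤pred[n] i)) ⟩
    sumUpTo (suc n) (λ a → reflectS f a * reflectS g (n ∸ a))   ≡⟨ mulS-sum (reflectS f) (reflectS g) n ⟨
    mulS (reflectS f) (reflectS g) n                            ∎
    where
    open ≡-Reasoning
    term : ∀ a → a ≤ n → sgn n * (f a * g (n ∸ a)) ≡ sgn a * f a * (sgn (n ∸ a) * g (n ∸ a))
    term a a≤n = sym (begin
      sgn a * f a * (sgn (n ∸ a) * g (n ∸ a))       ≡⟨ cong (λ s → sgn a * f a * (s * g (n ∸ a))) (sgn-∸ a≤n) ⟩
      sgn a * f a * (sgn n * sgn a * g (n ∸ a))     ≡⟨ solve 4 (λ s t x y → s :* x :* (t :* s :* y) := (s :* s) :* (t :* (x :* y))) refl (sgn a) (sgn n) (f a) (g (n ∸ a)) ⟩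
      (sgn a * sgn a) * (sgn n * (f a * g (n ∸ a))) ≡⟨ cong (_* (sgn n * (f a * g (n ∸ a)))) (sgn*sgn≡1 a) ⟩
      1ℚ * (sgn n * (f a * g (n ∸ a)))              ≡⟨ *-identityˡ _ ⟩
      sgn n * (f a * g (n ∸ a))                     ∎)

  reflectS-mulS-square : ∀ f g →
    mulS (reflectS (mulS f g)) (mulS f g) ≗ mulS (mulS (reflectS f) f) (mulS (reflectS g) g)
  reflectS-mulS-square f g n = begin
    mulS (reflectS (mulS f g)) (mulS f g) n                    ≡⟨ mulS-congˡ (mulS f g) (reflectS-mulS f g) n ⟩
    mulS (mulS (reflectS f) (reflectS g)) (mulS f g) n         ≡⟨ mulS-interchange (reflectS f) (reflectS g) f g n ⟩
    mulS (mulS (reflectS f) f) (mulS (reflectS g) g) n         ∎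
    where open ≡-Reasoning

  crossTerm : Series → ℕ → ℕ → ℚ
  crossTerm G k j = sgn (suc j) * G (k ∸ suc j) * G (k ℕ.+ suc j)

  reflectS-mulS-middle : ∀ G k → mulS (reflectS G) G (k ℕ.+ k) ≡ sgn k * G k * G k + two * sgn k * sumUpTo k (crossTerm G k)
  reflectS-mulS-middle G k = begin
    mulS (reflectS G) G (k ℕ.+ k)
      ≡⟨ mulS-sum (reflectS G) G (k ℕ.+ k) ⟩
    sumUpTo (suc (k ℕ.+ k)) φ
      ≡⟨ sumUpTo-middle k φ ⟩
    φ k + sumUpTo k (λ j → φ (k ∸ suc j) + φ (k ℕ.+ suc j))
      ≡⟨ cong₂ _+_ (cong (λ i → sgn k * G k * G i) (ℕ.m+n∸m≡n k k)) (sumUpTo-cong< k pair) ⟩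
    sgn k * G k * G k + sumUpTo k (λ j → two * sgn k * ψ j)
      ≡⟨ cong (sgn k * G k * G k +_) (∑-*ˡ {k} (two * sgn k) (ψ ∘ toℕ)) ⟩
    sgn k * G k * G k + two * sgn k * sumUpTo k ψ
      ∎
    where
    open ≡-Reasoning
    φ : ℕ → ℚ
    φ a = reflectS G a * G (k ℕ.+ k ∸ a)
    ψ = crossTerm G k
    pair : ∀ j → j < k → φ (k ∸ suc j) + φ (k ℕ.+ suc j) ≡ two * sgn k * ψ j
    pair j j<k = begin
      φ (k ∸ suc j) + φ (k ℕ.+ suc j)
        ≡⟨ cong₂ (λ u v → sgn (k ∸ suc j) * G (k ∸ suc j) * G u + sgn (k ℕ.+ suc j) * G (k ℕ.+ suc j) * G v)
             (trans (ℕ.+-∸-assoc k (ℕ.m∸n≤m k (suc j))) (cong (k ℕ.+_) (ℕ.m∸[m∸n]≡n j<k))) (ℕ.[m+n]∸[m+o]≡n∸o k k (suc j)) ⟩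
      sgn (k ∸ suc j) * G (k ∸ suc j) * G (k ℕ.+ suc j) + sgn (k ℕ.+ suc j) * G (k ℕ.+ suc j) * G (k ∸ suc j)
        ≡⟨ cong₂ (λ u v → u * G (k ∸ suc j) * G (k ℕ.+ suc j) + v * G (k ℕ.+ suc j) * G (k ∸ suc j)) (sgn-∸ j<k) (sgn-+ k (suc j)) ⟩
      sgn k * sgn (suc j) * G (k ∸ suc j) * G (k ℕ.+ suc j) + sgn k * sgn (suc j) * G (k ℕ.+ suc j) * G (k ∸ suc j)
        ≡⟨ solve 4 (λ s t a b → s :* t :* a :* b :+ s :* t :* b :* a := con two :* s :* (t :* a :* b)) refl (sgn k) (sgn (suc j)) (G (k ∸ suc j)) (G (k ℕ.+ suc j)) ⟩
      two * sgn k * ψ j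
        ∎

  -- The series ∏ (1 + x_i u) / (1 − x_i u) and ∏ (1 − t_j u)
  cayleyS : ℚ → Series
  cayleyS c = mulS (linS c) (geomS c)

  cayleyS-coeff : ∀ c m → cayleyS c m ≡ two * pow c m - oneS m
  cayleyS-coeff c zero    = mulS-linS-0 c (geomS c)
  cayleyS-coeff c (suc m) = trans (mulS-linS-suc c (geomS c) m)
    (solve 2 (λ p c → p :* c :+ c :* p := con two :* (p :* c) :- con 0ℚ) refl (pow c m) c)

  pow-neg : ∀ c n → pow (- c) n ≡ sgn n * pow c n
  pow-neg c zero    = refl
  pow-neg c (suc n) = trans (cong (_* (- c)) (pow-neg c n))
    (solve 3 (λ s p c → s :* p :* (:- c) := (:- s) :* (p :* c)) refl (sgn n) (pow c n) c)

  sgn*oneS : ∀ n → sgn n * oneS n ≡ oneS n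
  sgn*oneS zero    = refl
  sgn*oneS (suc n) = *-zeroʳ (sgn (suc n))

  reflectS-cayleyS : ∀ c → reflectS (cayleyS c) ≗ cayleyS (- c)
  reflectS-cayleyS c n = begin
    sgn n * cayleyS c n                         ≡⟨ cong (sgn n *_) (cayleyS-coeff c n) ⟩
    sgn n * (two * pow c n - oneS n)            ≡⟨ solve 3 (λ s p o → s :* (con two :* p :- o) := con two :* (s :* p) :- s :* o) refl (sgn n) (pow c n) (oneS n) ⟩
    two * (sgn n * pow c n) - sgn n * oneS n    ≡⟨ cong₂ (λ u v → two * u - v) (sym (pow-neg c n)) (sgn*oneS n) ⟩
    two * pow (- c) n - oneS n                  ≡⟨ cayleyS-coeff (- c) n ⟨
    cayleyS (- c) n                             ∎
    where open ≡-Reasoning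

  linS-geomS-inverse : ∀ c → mulS (linS (- c)) (geomS c) ≗ oneS
  linS-geomS-inverse c zero    = mulS-linS-0 (- c) (geomS c)
  linS-geomS-inverse c (suc n) = trans (mulS-linS-suc (- c) (geomS c) n)
    (solve 2 (λ p c → p :* c :+ (:- c) :* p := con 0ℚ) refl (pow c n) c)

  cayleyS-inverse : ∀ c → mulS (cayleyS (- c)) (cayleyS c) ≗ oneS
  cayleyS-inverse c n = begin
    mulS (mulS L⁻ G⁻) (mulS L G) n     ≡⟨ mulS-congʳ (mulS L⁻ G⁻) (mulS-comm L G) n ⟩
    mulS (mulS L⁻ G⁻) (mulS G L) n     ≡⟨ mulS-interchange L⁻ G⁻ G L n ⟩
    mulS (mulS L⁻ G) (mulS G⁻ L) n     ≡⟨ mulS-congˡ (mulS G⁻ L) (linS-geomS-inverse c) n ⟩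
    mulS oneS (mulS G⁻ L) n            ≡⟨ mulS-identityˡ (mulS G⁻ L) n ⟩
    mulS G⁻ L n                        ≡⟨ mulS-comm G⁻ L n ⟩
    mulS L G⁻ n                        ≡⟨ mulS-congˡ G⁻ (λ m → cong (λ v → linS v m) (solve 1 (λ c → c := :- (:- c)) refl c)) n ⟩
    mulS (linS (- (- c))) G⁻ n         ≡⟨ linS-geomS-inverse (- c) n ⟩
    oneS n                             ∎
    where
    open ≡-Reasoning
    L⁻ = linS (- c)
    G⁻ = geomS (- c)
    L = linS c
    G = geomS c

  cayleyProdS : ∀ {N} → (Fin N → ℚ) → Series
  cayleyProdS {N} x = foldr mulS oneS (map (λ i → cayleyS (x i)) (allFinL N))

  cayleyProdS-suc : ∀ {N} (x : Fin (suc N) → ℚ) → cayleyProdS x ≗ mulS (cayleyS (x zero)) (cayleyProdS (x ∘ suc))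
  cayleyProdS-suc {N} x n = cong (λ fs → mulS (cayleyS (x zero)) (foldr mulS oneS fs) n)
    (trans (List.map-tabulate suc (cayleyS ∘ x)) (sym (List.map-tabulate (λ i → i) (cayleyS ∘ x ∘ suc))))

  cayleyProdS-0 : ∀ {N} (x : Fin N → ℚ) → cayleyProdS x 0 ≡ 1ℚ
  cayleyProdS-0 {zero}  x = refl
  cayleyProdS-0 {suc N} x = begin
    cayleyProdS x 0                                     ≡⟨ cayleyProdS-suc x 0 ⟩
    mulS (cayleyS (x zero)) (cayleyProdS (x ∘ suc)) 0   ≡⟨ mulS-0 (cayleyS (x zero)) (cayleyProdS (x ∘ suc)) ⟩
    cayleyS (x zero) 0 * cayleyProdS (x ∘ suc) 0        ≡⟨ cong₂ _*_ (mulS-linS-0 (x zero) (geomS (x zero))) (cayleyProdS-0 (x ∘ suc)) ⟩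
    1ℚ                                                  ∎
    where open ≡-Reasoning

  reflectS-cayleyProdS-inverse : ∀ {N} (x : Fin N → ℚ) → mulS (reflectS (cayleyProdS x)) (cayleyProdS x) ≗ oneS
  reflectS-cayleyProdS-inverse {zero}  x n = trans (mulS-identityʳ (reflectS oneS) n) (sgn*oneS n)
  reflectS-cayleyProdS-inverse {suc N} x n = begin
    mulS (reflectS (cayleyProdS x)) (cayleyProdS x) n     ≡⟨ mulS-cong (λ m → cong (sgn m *_) (cayleyProdS-suc x m)) (cayleyProdS-suc x) n ⟩
    mulS (reflectS (mulS C X)) (mulS C X) n               ≡⟨ reflectS-mulS-square C X n ⟩
    mulS (mulS (reflectS C) C) (mulS (reflectS X) X) n    ≡⟨ mulS-cong C-inverse (reflectS-cayleyProdS-inverse (x ∘ suc)) n ⟩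
    mulS oneS oneS n                                      ≡⟨ mulS-identityˡ oneS n ⟩
    oneS n                                                ∎
    where
    open ≡-Reasoning
    C = cayleyS (x zero)
    X = cayleyProdS (x ∘ suc)
    C-inverse : mulS (reflectS C) C ≗ oneS
    C-inverse m = trans (mulS-congˡ C (reflectS-cayleyS (x zero)) m) (cayleyS-inverse (x zero) m)

  geomS-cayleyS-coeff : ∀ a y m → mulS (geomS y) (cayleyS a) m * (y - a) ≡ pow y m * (y + a) - two * (pow a m * a)
  geomS-cayleyS-coeff a y zero = begin
    mulS (geomS y) (cayleyS a) 0 * (y - a)   ≡⟨ cong (_* (y - a)) (mulS-0 (geomS y) (cayleyS a)) ⟩
    1ℚ * cayleyS a 0 * (y - a)               ≡⟨ cong (λ v → 1ℚ * v * (y - a)) (mulS-linS-0 a (geomS a)) ⟩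
    1ℚ * 1ℚ * (y - a)                        ≡⟨ solve 2 (λ a y → con 1ℚ :* con 1ℚ :* (y :- a) := con 1ℚ :* (y :+ a) :- con two :* (con 1ℚ :* a)) refl a y ⟩
    1ℚ * (y + a) - two * (1ℚ * a)            ∎
    where open ≡-Reasoning
  geomS-cayleyS-coeff a y (suc m) = begin
    mulS (geomS y) (cayleyS a) (suc m) * (y - a)           ≡⟨ cong (_* (y - a)) (mulS-geomS-suc y (cayleyS a) m) ⟩
    (cayleyS a (suc m) + y * K) * (y - a)                  ≡⟨ cong (λ v → (v + y * K) * (y - a)) (cayleyS-coeff a (suc m)) ⟩
    (two * (A * a) - 0ℚ + y * K) * (y - a)                 ≡⟨ solve 4 (λ A a y K → (con two :* (A :* a) :- con 0ℚ :+ y :* K) :* (y :- a)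
                                                                      := con two :* (A :* a) :* (y :- a) :+ y :* (K :* (y :- a))) refl A a y K ⟩
    two * (A * a) * (y - a) + y * (K * (y - a))            ≡⟨ cong (λ v → two * (A * a) * (y - a) + y * v) (geomS-cayleyS-coeff a y m) ⟩
    two * (A * a) * (y - a) + y * (Y * (y + a) - two * (A * a))
                                                           ≡⟨ solve 4 (λ A a y Y → con two :* (A :* a) :* (y :- a) :+ y :* (Y :* (y :+ a) :- con two :* (A :* a))
                                                                      := Y :* y :* (y :+ a) :- con two :* (A :* a :* a)) refl A a y Y ⟩
    Y * y * (y + a) - two * (A * a * a)                    ∎
    where
    open ≡-Reasoning
    K = mulS (geomS y) (cayleyS a) m
    A = pow a m
    Y = pow y m

  esym-degree : ∀ t m → DegreeAtMost m (esym t m)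
  esym-degree t zero    b = refl
  esym-degree t (suc m) b = begin
    esym t m (suc (suc m ℕ.+ b)) + t (suc m) * esym t m (suc (m ℕ.+ b))  ≡⟨ cong₂ (λ u v → u + t (suc m) * v) (DegreeAtMost-suc (esym t m) (esym-degree t m) b) (esym-degree t m b) ⟩
    0ℚ + t (suc m) * 0ℚ                                                  ≡⟨ solve 1 (λ x → con 0ℚ :+ x :* con 0ℚ := con 0ℚ) refl (t (suc m)) ⟩
    0ℚ                                                                   ∎
    where open ≡-Reasoning

  tPoly : ℕ → (ℕ → ℚ) → Series
  tPoly k t = foldr mulS oneS (map (λ j → linS (- t j)) (map suc (upTo k)))

  tPoly-snoc : ∀ k t → tPoly (suc k) t ≗ mulS (tPoly k t) (linS (- t (suc k)))
  tPoly-snoc k t n = begin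
    tPoly (suc k) t n                                           ≡⟨ cong (λ fs → foldr mulS oneS fs n) (factors (suc k)) ⟩
    foldr mulS oneS (applyUpTo L (suc k)) n                     ≡⟨ cong (λ fs → foldr mulS oneS fs n) (List.applyUpTo-∷ʳ L k) ⟨
    foldr mulS oneS (applyUpTo L k ∷ʳ L k) n                    ≡⟨ cong (λ s → s n) (List.foldr-∷ʳ mulS oneS (L k) (applyUpTo L k)) ⟩
    foldr mulS (mulS (L k) oneS) (applyUpTo L k) n              ≡⟨ foldr-mulS (applyUpTo L k) (mulS (L k) oneS) n ⟩
    mulS (foldr mulS oneS (applyUpTo L k)) (mulS (L k) oneS) n  ≡⟨ mulS-cong (λ m → cong (λ fs → foldr mulS oneS fs m) (sym (factors k))) (mulS-identityʳ (L k)) n ⟩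
    mulS (tPoly k t) (L k) n                                    ∎
    where
    open ≡-Reasoning
    L : ℕ → Series
    L j = linS (- t (suc j))
    factors : ∀ k → map (λ j → linS (- t j)) (map suc (upTo k)) ≡ applyUpTo L k
    factors k = trans (sym (List.map-∘ (upTo k))) (List.map-upTo L k)

  tPoly-suc : ∀ k t n → tPoly (suc k) t (suc n) ≡ tPoly k t (suc n) + (- t (suc k)) * tPoly k t n
  tPoly-suc k t n = begin
    tPoly (suc k) t (suc n)                               ≡⟨ tPoly-snoc k t (suc n) ⟩
    mulS (tPoly k t) (linS (- t (suc k))) (suc n)         ≡⟨ mulS-comm (tPoly k t) (linS (- t (suc k))) (suc n) ⟩
    mulS (linS (- t (suc k))) (tPoly k t) (suc n)         ≡⟨ mulS-linS-suc (- t (suc k)) (tPoly k t) n ⟩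
    tPoly k t (suc n) + (- t (suc k)) * tPoly k t n       ∎
    where open ≡-Reasoning

  tPoly-0 : ∀ k t → tPoly k t 0 ≡ 1ℚ
  tPoly-0 zero    t = refl
  tPoly-0 (suc k) t = begin
    tPoly (suc k) t 0                              ≡⟨ tPoly-snoc k t 0 ⟩
    mulS (tPoly k t) (linS (- t (suc k))) 0        ≡⟨ mulS-comm (tPoly k t) (linS (- t (suc k))) 0 ⟩
    mulS (linS (- t (suc k))) (tPoly k t) 0        ≡⟨ mulS-linS-0 (- t (suc k)) (tPoly k t) ⟩
    tPoly k t 0                                    ≡⟨ tPoly-0 k t ⟩
    1ℚ                                             ∎
    where open ≡-Reasoning

  tPoly-degree : ∀ k t → DegreeAtMost k (tPoly k t)
  tPoly-degree zero    t b = refl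
  tPoly-degree (suc k) t b = begin
    tPoly (suc k) t (suc (suc k ℕ.+ b))                                   ≡⟨ tPoly-suc k t (suc k ℕ.+ b) ⟩
    tPoly k t (suc (suc k ℕ.+ b)) + (- t (suc k)) * tPoly k t (suc k ℕ.+ b) ≡⟨ cong₂ (λ u v → u + (- t (suc k)) * v) (DegreeAtMost-suc (tPoly k t) (tPoly-degree k t) b) (tPoly-degree k t b) ⟩
    0ℚ + (- t (suc k)) * 0ℚ                                               ≡⟨ solve 1 (λ x → con 0ℚ :+ (:- x) :* con 0ℚ := con 0ℚ) refl (t (suc k)) ⟩
    0ℚ                                                                    ∎
    where open ≡-Reasoning

  tPoly-top : ∀ k t → tPoly k t k ≡ sgn k * esym t k k
  tPoly-top zero    t = refl
  tPoly-top (suc k) t = begin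
    tPoly (suc k) t (suc k)                                    ≡⟨ tPoly-suc k t k ⟩
    tPoly k t (suc k) + (- t (suc k)) * tPoly k t k            ≡⟨ cong₂ (λ u v → u + (- t (suc k)) * v) (DegreeAtMost⇒next≡0 (tPoly k t) (tPoly-degree k t)) (tPoly-top k t) ⟩
    0ℚ + (- t (suc k)) * (sgn k * esym t k k)                  ≡⟨ solve 3 (λ x s e → con 0ℚ :+ (:- x) :* (s :* e) := (:- s) :* (con 0ℚ :+ x :* e)) refl (t (suc k)) (sgn k) (esym t k k) ⟩
    - sgn k * (0ℚ + t (suc k) * esym t k k)                    ≡⟨ cong (λ v → - sgn k * (v + t (suc k) * esym t k k)) (DegreeAtMost⇒next≡0 (esym t k) (esym-degree t k)) ⟨
    sgn (suc k) * esym t (suc k) (suc k)                       ∎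
    where open ≡-Reasoning

  facPow≡coeff : ∀ k t y → facPow t y k ≡ mulS (geomS y) (tPoly k t) k
  facPow≡coeff zero    t y = sym (mulS-0 (geomS y) oneS)
  facPow≡coeff (suc k) t y = sym (begin
    mulS (geomS y) (tPoly (suc k) t) (suc k)                   ≡⟨ mulS-congʳ (geomS y) (tPoly-snoc k t) (suc k) ⟩
    mulS (geomS y) (mulS T L) (suc k)                          ≡⟨ mulS-assoc (geomS y) T L (suc k) ⟨
    mulS F L (suc k)                                           ≡⟨ mulS-comm F L (suc k) ⟩
    mulS L F (suc k)                                           ≡⟨ mulS-linS-suc (- t (suc k)) F k ⟩
    F (suc k) + (- t (suc k)) * F k                            ≡⟨ cong (_+ (- t (suc k)) * F k) (mulS-geomS-suc y T k) ⟩
    T (suc k) + y * F k + (- t (suc k)) * F k                  ≡⟨ cong (λ v → v + y * F k + (- t (suc k)) * F k) (DegreeAtMost⇒next≡0 (tPoly k t) (tPoly-degree k t)) ⟩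
    0ℚ + y * F k + (- t (suc k)) * F k                         ≡⟨ solve 3 (λ y c f → con 0ℚ :+ y :* f :+ (:- c) :* f := f :* (y :- c)) refl y (t (suc k)) (F k) ⟩
    F k * (y - t (suc k))                                      ≡⟨ cong (_* (y - t (suc k))) (facPow≡coeff k t y) ⟨
    facPow t y (suc k)                                         ∎)
    where
    open ≡-Reasoning
    T = tPoly k t
    L = linS (- t (suc k))
    F = mulS (geomS y) T

  -- Partial fractions
  pairFactor : ℚ → ℚ → ℚ
  pairFactor p q = div (p + q) (p - q)

  pairFactor-expand : ∀ {p q} → p ≢ q → pairFactor p q ≡ 1ℚ + two * q * inv (p - q)
  pairFactor-expand {p} {q} p≢q = begin
    div (p + q) (p - q)                          ≡⟨ div≡*inv (p + q) (p - q) ⟩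
    (p + q) * inv (p - q)                        ≡⟨ solve 3 (λ p q I → (p :+ q) :* I := (p :- q) :* I :+ con two :* q :* I) refl p q (inv (p - q)) ⟩
    (p - q) * inv (p - q) + two * q * inv (p - q) ≡⟨ cong (_+ two * q * inv (p - q)) (*-inv (≢⇒-≢0 p≢q)) ⟩
    1ℚ + two * q * inv (p - q)                   ∎
    where open ≡-Reasoning

  weight : ∀ {n} → (Fin n → ℚ) → Fin n → ℚ
  weight {suc n} y i = prod (λ j → pairFactor (y i) (y (punchIn i j)))

  weight-suc : ∀ {n} (y : Fin (suc n) → ℚ) i → weight y (suc i) ≡ pairFactor (y (suc i)) (y zero) * weight (y ∘ suc) i
  weight-suc {suc n} y i = refl

  pfSum : ∀ {n} → (Fin n → ℚ) → ℚ → ℚ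
  pfSum {n} y z = ∑[ i < n ] (y i * weight y i * inv (z - y i))

  Injective-suc : ∀ {n} {y : Fin (suc n) → ℚ} → Injective _≡_ _≡_ y → Injective _≡_ _≡_ (y ∘ suc)
  Injective-suc y-inj = suc-injective ∘ y-inj

  Injective-zero≢suc : ∀ {n} {y : Fin (suc n) → ℚ} → Injective _≡_ _≡_ y → ∀ i → y zero ≢ y (suc i)
  Injective-zero≢suc y-inj i = 0≢1+n ∘ y-inj

  partialFraction-step : ∀ {z a y} w → z ≢ a → z ≢ y → a ≢ y →
    pairFactor z a * (y * w * inv (z - y)) ≡
    two * a * inv (z - a) * (y * w * inv (a - y)) + y * (pairFactor y a * w) * inv (z - y)
  partialFraction-step {z} {a} {y} w z≢a z≢y a≢y = begin
    pairFactor z a * (y * w * J)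
      ≡⟨ cong (_* (y * w * J)) (pairFactor-expand z≢a) ⟩
    (1ℚ + two * a * I) * (y * w * J)
      ≡⟨ solve 5 (λ a y w I J → (con 1ℚ :+ con two :* a :* I) :* (y :* w :* J) := y :* w :* J :+ con two :* a :* y :* w :* (I :* J)) refl a y w I J ⟩
    y * w * J + two * a * y * w * (I * J)
      ≡⟨ cong (λ v → y * w * J + two * a * y * w * v) (inv-partialFraction z≢a z≢y a≢y) ⟩
    y * w * J + two * a * y * w * ((I - J) * K)
      ≡⟨ solve 6 (λ a y w I J K → y :* w :* J :+ con two :* a :* y :* w :* ((I :- J) :* K)
                               := con two :* a :* I :* (y :* w :* K) :+ y :* ((con 1ℚ :+ con two :* a :* (:- K)) :* w) :* J) refl a y w I J K ⟩
    two * a * I * (y * w * K) + y * ((1ℚ + two * a * (- K)) * w) * J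
      ≡⟨ cong (λ v → two * a * I * (y * w * K) + y * ((1ℚ + two * a * v) * w) * J) (inv-swap a≢y) ⟨
    two * a * I * (y * w * K) + y * ((1ℚ + two * a * inv (y - a)) * w) * J
      ≡⟨ cong (λ v → two * a * I * (y * w * K) + y * (v * w) * J) (pairFactor-expand (a≢y ∘ sym)) ⟨
    two * a * I * (y * w * K) + y * (pairFactor y a * w) * J
      ∎
    where
    open ≡-Reasoning
    I = inv (z - a)
    J = inv (z - y)
    K = inv (a - y)

  partialFractions : ∀ {n} (y : Fin n → ℚ) → Injective _≡_ _≡_ y → ∀ {z} → (∀ j → z ≢ y j) →
    prod (λ j → pairFactor z (y j)) ≡ 1ℚ + two * pfSum y z
  partialFractions {zero}  y  _      _    = refl
  partialFractions {suc n} y′ y′-inj {z} z∉y′ = begin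
    pairFactor z a * prod (λ j → pairFactor z (y j))
      ≡⟨ cong (pairFactor z a *_) (partialFractions y y-inj (z∉y′ ∘ suc)) ⟩
    pairFactor z a * (1ℚ + two * pfSum y z)
      ≡⟨ solve 2 (λ h s → h :* (con 1ℚ :+ con two :* s) := h :+ con two :* (h :* s)) refl (pairFactor z a) (pfSum y z) ⟩
    pairFactor z a + two * (pairFactor z a * pfSum y z)
      ≡⟨ cong₂ (λ u v → u + two * v) (pairFactor-expand (z∉y′ zero)) shift ⟩
    1ℚ + two * a * I + two * (two * a * I * pfSum y a + rest)
      ≡⟨ solve 4 (λ a I s r → con 1ℚ :+ con two :* a :* I :+ con two :* (con two :* a :* I :* s :+ r)
                           := con 1ℚ :+ con two :* (a :* (con 1ℚ :+ con two :* s) :* I :+ r)) refl a I (pfSum y a) rest ⟩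
    1ℚ + two * (a * (1ℚ + two * pfSum y a) * I + rest)
      ≡⟨ cong (λ v → 1ℚ + two * (a * v * I + rest)) (partialFractions y y-inj a∉y) ⟨
    1ℚ + two * pfSum y′ z
      ∎
    where
    open ≡-Reasoning
    a = y′ zero
    y = y′ ∘ suc
    y-inj = Injective-suc y′-inj
    a∉y = Injective-zero≢suc y′-inj
    I = inv (z - a)
    rest = ∑[ i < n ] (y i * weight y′ (suc i) * inv (z - y i))
    shift : pairFactor z a * pfSum y z ≡ two * a * I * pfSum y a + rest
    shift = begin
      pairFactor z a * pfSum y z
        ≡⟨ *-distribˡ-sum {n} (pairFactor z a) (λ i → y i * weight y i * inv (z - y i)) ⟩
      ∑[ i < n ] (pairFactor z a * (y i * weight y i * inv (z - y i)))
        ≡⟨ sum-cong-≗ {n} (λ i → trans (partialFraction-step (weight y i) (z∉y′ zero) (z∉y′ (suc i)) (a∉y i))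
                                        (cong (λ v → two * a * I * (y i * weight y i * inv (a - y i)) + y i * v * inv (z - y i)) (sym (weight-suc y′ i)))) ⟩
      ∑[ i < n ] (two * a * I * (y i * weight y i * inv (a - y i)) + y i * weight y′ (suc i) * inv (z - y i))
        ≡⟨ ∑-distrib-+ {n} (λ i → two * a * I * (y i * weight y i * inv (a - y i))) (λ i → y i * weight y′ (suc i) * inv (z - y i)) ⟩
      ∑[ i < n ] (two * a * I * (y i * weight y i * inv (a - y i))) + rest
        ≡⟨ cong (_+ rest) (*-distribˡ-sum {n} (two * a * I) (λ i → y i * weight y i * inv (a - y i))) ⟨
      two * a * I * pfSum y a + rest
        ∎

  cayleyS-geomS-partialFraction : ∀ {a y} w m → a ≢ y →
    mulS (cayleyS a) (λ j → pow y j * w) m ≡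
    two * pow a m * (y * w * inv (a - y)) + (two * pow a m * w + pow y m * (pairFactor y a * w))
  cayleyS-geomS-partialFraction {a} {y} w m a≢y = begin
    mulS (cayleyS a) (λ j → pow y j * w) m     ≡⟨ mulS-congʳ (cayleyS a) (λ j → *-comm (pow y j) w) m ⟩
    mulS (cayleyS a) (λ j → w * pow y j) m     ≡⟨ mulS-*ʳ w (cayleyS a) (geomS y) m ⟩
    w * mulS (cayleyS a) (geomS y) m           ≡⟨ cong (w *_) (mulS-comm (cayleyS a) (geomS y) m) ⟩
    w * K                                      ≡⟨ sym (*-cancelʳ (y - a) (≢⇒-≢0 (a≢y ∘ sym)) scaled) ⟩
    two * A * (y * w * I) + (two * A * w + Y * (pairFactor y a * w)) ∎
    where
    open ≡-Reasoning
    K = mulS (geomS y) (cayleyS a) m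
    A = pow a m
    Y = pow y m
    I = inv (a - y)
    J = inv (y - a)
    scaled : (two * A * (y * w * I) + (two * A * w + Y * (pairFactor y a * w))) * (y - a) ≡ w * K * (y - a)
    scaled = begin
      (two * A * (y * w * I) + (two * A * w + Y * (pairFactor y a * w))) * (y - a)
        ≡⟨ cong (λ v → (two * A * (y * w * I) + (two * A * w + Y * (v * w))) * (y - a)) (div≡*inv (y + a) (y - a)) ⟩
      (two * A * (y * w * I) + (two * A * w + Y * ((y + a) * J * w))) * (y - a)
        ≡⟨ solve 7 (λ a y w A Y I J → (con two :* A :* (y :* w :* I) :+ (con two :* A :* w :+ Y :* ((y :+ a) :* J :* w))) :* (y :- a)
                                    := (:- (con two :* A :* y :* w)) :* ((a :- y) :* I) :+ con two :* A :* w :* (y :- a) :+ Y :* (y :+ a) :* w :* ((y :- a) :* J))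
                                    refl a y w A Y I J ⟩
      (- (two * A * y * w)) * ((a - y) * I) + two * A * w * (y - a) + Y * (y + a) * w * ((y - a) * J)
        ≡⟨ cong₂ (λ u v → (- (two * A * y * w)) * u + two * A * w * (y - a) + Y * (y + a) * w * v) (*-inv (≢⇒-≢0 a≢y)) (*-inv (≢⇒-≢0 (a≢y ∘ sym))) ⟩
      (- (two * A * y * w)) * 1ℚ + two * A * w * (y - a) + Y * (y + a) * w * 1ℚ
        ≡⟨ solve 5 (λ a y w A Y → (:- (con two :* A :* y :* w)) :* con 1ℚ :+ con two :* A :* w :* (y :- a) :+ Y :* (y :+ a) :* w :* con 1ℚ
                                := w :* (Y :* (y :+ a) :- con two :* (A :* a))) refl a y w A Y ⟩
      w * (Y * (y + a) - two * (A * a))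
        ≡⟨ cong (w *_) (geomS-cayleyS-coeff a y m) ⟨
      w * (K * (y - a))
        ≡⟨ solve 3 (λ w K d → w :* (K :* d) := w :* K :* d) refl w K (y - a) ⟩
      w * K * (y - a)
        ∎

  cayleyProdS-coeff : ∀ {n} (y : Fin n → ℚ) → Injective _≡_ _≡_ y → ∀ m →
    cayleyProdS y m ≡ two * ∑[ i < n ] (pow (y i) m * weight y i) + sgn n * oneS m
  weight-sum : ∀ {n} (y : Fin n → ℚ) → Injective _≡_ _≡_ y → two * ∑[ i < n ] weight y i ≡ 1ℚ - sgn n

  weight-sum {n} y y-inj = begin
    two * ∑[ i < n ] weight y i                                      ≡⟨ cong (two *_) (sum-cong-≗ {n} (λ i → sym (*-identityˡ (weight y i)))) ⟩
    two * ∑[ i < n ] (1ℚ * weight y i)                               ≡⟨ solve 2 (λ S s → con two :* S := (con two :* S :+ s :* con 1ℚ) :- s) refl (∑[ i < n ] (1ℚ * weight y i)) (sgn n) ⟩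
    (two * ∑[ i < n ] (1ℚ * weight y i) + sgn n * 1ℚ) - sgn n        ≡⟨ cong (_- sgn n) (cayleyProdS-coeff y y-inj 0) ⟨
    cayleyProdS y 0 - sgn n                                          ≡⟨ cong (_- sgn n) (cayleyProdS-0 y) ⟩
    1ℚ - sgn n                                                       ∎
    where open ≡-Reasoning

  cayleyProdS-coeff {zero}  y _ m = solve 1 (λ o → o := con two :* con 0ℚ :+ con 1ℚ :* o) refl (oneS m)
  cayleyProdS-coeff {suc n} y′ y′-inj m = begin
    cayleyProdS y′ m
      ≡⟨ cayleyProdS-suc y′ m ⟩
    mulS C (cayleyProdS y) m
      ≡⟨ mulS-congʳ C (cayleyProdS-coeff y y-inj) m ⟩
    mulS C (λ m → two * P m + sgn n * oneS m) m
      ≡⟨ mulS-+ʳ C (λ m → two * P m) (λ m → sgn n * oneS m) m ⟩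
    mulS C (λ m → two * P m) m + mulS C (λ m → sgn n * oneS m) m
      ≡⟨ cong₂ _+_ (mulS-*ʳ two C P m) (mulS-*ʳ (sgn n) C oneS m) ⟩
    two * mulS C P m + sgn n * mulS C oneS m
      ≡⟨ cong₂ (λ u v → two * u + sgn n * v) (mulS-∑ʳ C (λ i m → pow (y i) m * weight y i) m) (mulS-identityʳ C m) ⟩
    two * ∑[ i < n ] mulS C (λ m → pow (y i) m * weight y i) m + sgn n * C m
      ≡⟨ cong₂ (λ u v → two * u + sgn n * v) (sum-cong-≗ {n} term) (cayleyS-coeff a m) ⟩
    two * ∑[ i < n ] (two * A * (y i * weight y i * inv (a - y i)) + (two * A * weight y i + pow (y i) m * weight y′ (suc i)))
      + sgn n * (two * A - oneS m)
      ≡⟨ cong (λ v → two * v + sgn n * (two * A - oneS m)) split ⟩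
    two * (two * A * pfSum y a + (A * (two * ∑[ i < n ] weight y i) + rest)) + sgn n * (two * A - oneS m)
      ≡⟨ cong (λ v → two * (two * A * pfSum y a + (A * v + rest)) + sgn n * (two * A - oneS m)) (weight-sum y y-inj) ⟩
    two * (two * A * pfSum y a + (A * (1ℚ - sgn n) + rest)) + sgn n * (two * A - oneS m)
      ≡⟨ solve 5 (λ A S r s o → con two :* (con two :* A :* S :+ (A :* (con 1ℚ :- s) :+ r)) :+ s :* (con two :* A :- o)
                             := con two :* (A :* (con 1ℚ :+ con two :* S) :+ r) :+ (:- s) :* o) refl A (pfSum y a) rest (sgn n) (oneS m) ⟩
    two * (A * (1ℚ + two * pfSum y a) + rest) + sgn (suc n) * oneS m
      ≡⟨ cong (λ v → two * (A * v + rest) + sgn (suc n) * oneS m) (partialFractions y y-inj a∉y) ⟨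
    two * ∑[ i < suc n ] (pow (y′ i) m * weight y′ i) + sgn (suc n) * oneS m
      ∎
    where
    open ≡-Reasoning
    a = y′ zero
    y = y′ ∘ suc
    y-inj = Injective-suc y′-inj
    a∉y = Injective-zero≢suc y′-inj
    C = cayleyS a
    A = pow a m
    P = λ m → ∑[ i < n ] (pow (y i) m * weight y i)
    rest = ∑[ i < n ] (pow (y i) m * weight y′ (suc i))
    term : ∀ i → mulS C (λ m → pow (y i) m * weight y i) m ≡
                 two * A * (y i * weight y i * inv (a - y i)) + (two * A * weight y i + pow (y i) m * weight y′ (suc i))
    term i = trans (cayleyS-geomS-partialFraction (weight y i) m (a∉y i))
      (cong (λ v → two * A * (y i * weight y i * inv (a - y i)) + (two * A * weight y i + pow (y i) m * v)) (sym (weight-suc y′ i)))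
    split : ∑[ i < n ] (two * A * (y i * weight y i * inv (a - y i)) + (two * A * weight y i + pow (y i) m * weight y′ (suc i)))
            ≡ two * A * pfSum y a + (A * (two * ∑[ i < n ] weight y i) + rest)
    split = begin
      ∑[ i < n ] (two * A * (y i * weight y i * inv (a - y i)) + (two * A * weight y i + pow (y i) m * weight y′ (suc i)))
        ≡⟨ ∑-distrib-+ {n} _ _ ⟩
      ∑[ i < n ] (two * A * (y i * weight y i * inv (a - y i))) + ∑[ i < n ] (two * A * weight y i + pow (y i) m * weight y′ (suc i))
        ≡⟨ cong₂ _+_ (∑-*ˡ (two * A) (λ i → y i * weight y i * inv (a - y i))) (∑-distrib-+ {n} _ _) ⟩
      two * A * pfSum y a + (∑[ i < n ] (two * A * weight y i) + rest)
        ≡⟨ cong (λ v → two * A * pfSum y a + (v + rest)) (∑-*ˡ (two * A) (weight y)) ⟩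
      two * A * pfSum y a + (two * A * ∑[ i < n ] weight y i + rest)
        ≡⟨ cong (λ v → two * A * pfSum y a + (v + rest)) (solve 2 (λ A W → con two :* A :* W := A :* (con two :* W)) refl A (∑[ i < n ] weight y i)) ⟩
      two * A * pfSum y a + (A * (two * ∑[ i < n ] weight y i) + rest)
        ∎

  -- Symmetrisation
  ProductInvariant : ∀ {n} → (Fin n → Fin n) → Set
  ProductInvariant {n} σ = ∀ (g : Fin n → ℚ) → prod (g ∘ σ) ≡ prod g

  extend-productInvariant : ∀ {n} i {σ : Fin n → Fin n} → ProductInvariant σ → ProductInvariant (extend i σ)
  extend-productInvariant i {σ} σ-inv g = begin
    g i * prod (λ j → g (punchIn i (σ j)))   ≡⟨ cong (g i *_) (σ-inv (λ j → g (punchIn i j))) ⟩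
    g i * prod (λ j → g (punchIn i j))       ≡⟨ prod-remove g ⟨
    prod g                                   ∎
    where open ≡-Reasoning

  perms-productInvariant : ∀ n → All ProductInvariant (perms n)
  perms-productInvariant zero    = (λ g → refl) ∷ []
  perms-productInvariant (suc n) = concat⁺ (map⁺ (All.map extensions (perms-productInvariant n)))
    where
    extensions : ∀ {σ} → ProductInvariant σ → All ProductInvariant (map (λ i → extend i σ) (allFinL (suc n)))
    extensions σ-inv = map⁺ (All.universal (λ i → extend-productInvariant i σ-inv) (allFinL (suc n)))

  length-perms : ∀ n → length (perms n) ≡ n !
  length-perms zero    = refl
  length-perms (suc n) = trans (length-concat (perms n)) (trans (cong (ℕ._* suc n) (length-perms n)) (ℕ.*-comm (n !) (suc n)))
    where
    length-concat : ∀ (σs : List (Fin n → Fin n)) →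
      length (concatMap (λ σ → map (λ i → extend i σ) (allFinL (suc n))) σs) ≡ length σs ℕ.* suc n
    length-concat []       = refl
    length-concat (σ ∷ σs) = begin
      length (map (λ i → extend i σ) (allFinL (suc n)) ++ _)     ≡⟨ List.length-++ (map (λ i → extend i σ) (allFinL (suc n))) ⟩
      length (map (λ i → extend i σ) (allFinL (suc n))) ℕ.+ _    ≡⟨ cong₂ ℕ._+_ (trans (List.length-map _ (allFinL (suc n))) (List.length-tabulate (λ i → i))) (length-concat σs) ⟩
      suc n ℕ.+ length σs ℕ.* suc n                              ∎
      where open ≡-Reasoning

  sumL-perms : ∀ {M} (F : (Fin (suc M) → Fin (suc M)) → ℚ) (v : Fin (suc M) → ℚ) →
    (∀ i {σ} → ProductInvariant σ → F (extend i σ) ≡ v i) →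
    sumL (map F (perms (suc M))) ≡ fromℕ (M !) * ∑[ i < suc M ] v i
  sumL-perms {M} F v F-ext = trans (over (perms M) (perms-productInvariant M)) (cong (λ n → fromℕ n * V) (length-perms M))
    where
    open ≡-Reasoning
    V = ∑[ i < suc M ] v i
    extensions : (Fin M → Fin M) → List (Fin (suc M) → Fin (suc M))
    extensions σ = map (λ i → extend i σ) (allFinL (suc M))
    over-extensions : ∀ {σ} → ProductInvariant σ → sumL (map F (extensions σ)) ≡ V
    over-extensions {σ} σ-inv = begin
      sumL (map F (extensions σ))                          ≡⟨ cong sumL (List.map-∘ {g = F} {f = λ i → extend i σ} (allFinL (suc M))) ⟨
      sumL (map (λ i → F (extend i σ)) (allFinL (suc M)))  ≡⟨ cong sumL (List.map-tabulate (λ i → i) (λ i → F (extend i σ))) ⟩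
      sumL (tabulate (λ i → F (extend i σ)))               ≡⟨ sumL-tabulate (λ i → F (extend i σ)) ⟩
      ∑[ i < suc M ] F (extend i σ)                        ≡⟨ sum-cong-≗ {suc M} (λ i → F-ext i σ-inv) ⟩
      V                                                    ∎
    over : ∀ σs → All ProductInvariant σs → sumL (map F (concatMap extensions σs)) ≡ fromℕ (length σs) * V
    over []       []               = sym (*-zeroˡ V)
    over (σ ∷ σs) (σ-inv ∷ σs-inv) = begin
      sumL (map F (extensions σ ++ concatMap extensions σs))              ≡⟨ cong sumL (List.map-++ F (extensions σ) (concatMap extensions σs)) ⟩
      sumL (map F (extensions σ) ++ map F (concatMap extensions σs))      ≡⟨ sumL-++ (map F (extensions σ)) (map F (concatMap extensions σs)) ⟩
      sumL (map F (extensions σ)) + sumL (map F (concatMap extensions σs)) ≡⟨ cong₂ _+_ (over-extensions σ-inv) (over σs σs-inv) ⟩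
      V + fromℕ (length σs) * V                                           ≡⟨ solve 2 (λ V c → V :+ c :* V := (con 1ℚ :+ c) :* V) refl V (fromℕ (length σs)) ⟩
      (1ℚ + fromℕ (length σs)) * V                                        ≡⟨ cong (_* V) (fromℕ-suc (length σs)) ⟨
      fromℕ (suc (length σs)) * V                                         ∎

  PλSummand-single : ∀ {M} k t (x : Fin (suc M) → ℚ) → PλSummand (s≤s z≤n) [ k ] t x ≡ facPow t (x zero) k * weight x zero
  PλSummand-single {M} k t x = begin
    facPow t (x zero) k * 1ℚ * (prodL (map h (above zero)) * 1ℚ)      ≡⟨ cong (λ l → facPow t (x zero) k * 1ℚ * (prodL (map h l) * 1ℚ)) above-zero ⟩
    facPow t (x zero) k * 1ℚ * (prodL (map h (tabulate suc)) * 1ℚ)    ≡⟨ cong (λ p → facPow t (x zero) k * 1ℚ * (p * 1ℚ)) (trans (cong prodL (List.map-tabulate suc h)) (prodL-tabulate (h ∘ suc))) ⟩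
    facPow t (x zero) k * 1ℚ * (weight x zero * 1ℚ)                   ≡⟨ solve 2 (λ a b → a :* con 1ℚ :* (b :* con 1ℚ) := a :* b) refl (facPow t (x zero) k) (weight x zero) ⟩
    facPow t (x zero) k * weight x zero                               ∎
    where
    open ≡-Reasoning
    h : Fin (suc M) → ℚ
    h j = div (x zero + x j) (x zero - x j)
    above-zero : above {suc M} zero ≡ tabulate suc
    above-zero = List.filter-all (λ (j : Fin (suc M)) → zero {n = M} <ᶠ? j) (tabulate⁺ {f = suc} (λ _ → ℕ.z<s))

  Pk≡weightedSum : ∀ M k t (x : Fin (suc M) → ℚ) → Pk M k t x ≡ ∑[ i < suc M ] (facPow t (x i) k * weight x i)
  Pk≡weightedSum M k t x = begin
    div (sumL (map (λ w → PλSummand (s≤s z≤n) [ k ] t (x ∘ w)) (perms (suc M)))) (fromℕ (M !))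
      ≡⟨ cong (λ v → div v (fromℕ (M !))) (sumL-perms (λ w → PλSummand (s≤s z≤n) [ k ] t (x ∘ w)) (λ i → facPow t (x i) k * weight x i) summand) ⟩
    div (fromℕ (M !) * ∑[ i < suc M ] (facPow t (x i) k * weight x i)) (fromℕ (M !))
      ≡⟨ div-*-cancelˡ (fromℕ≢0 (M !) {{M ℕ.!≢0}}) _ ⟩
    ∑[ i < suc M ] (facPow t (x i) k * weight x i)
      ∎
    where
    open ≡-Reasoning
    summand : ∀ i {σ} → ProductInvariant σ → PλSummand (s≤s z≤n) [ k ] t (x ∘ extend i σ) ≡ facPow t (x i) k * weight x i
    summand i {σ} σ-inv = trans (PλSummand-single k t (x ∘ extend i σ))
      (cong (facPow t (x i) k *_) (σ-inv (λ j → pairFactor (x i) (x (punchIn i j)))))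

  -- The generating function of the P^(k)_i
  genS-0 : ∀ {N} k t (x : Fin N → ℚ) → genS k t x 0 ≡ 1ℚ
  genS-0 k t x = begin
    mulS (cayleyProdS x) (tPoly k t) 0     ≡⟨ mulS-0 (cayleyProdS x) (tPoly k t) ⟩
    cayleyProdS x 0 * tPoly k t 0          ≡⟨ cong₂ _*_ (cayleyProdS-0 x) (tPoly-0 k t) ⟩
    1ℚ                                     ∎
    where open ≡-Reasoning

  genS-reflected-square : ∀ {N} k t (x : Fin N → ℚ) →
    mulS (reflectS (genS k t x)) (genS k t x) (k ℕ.+ k) ≡ sgn k * tPoly k t k * tPoly k t k
  genS-reflected-square k t x = begin
    mulS (reflectS (mulS X T)) (mulS X T) (k ℕ.+ k)             ≡⟨ reflectS-mulS-square X T (k ℕ.+ k) ⟩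
    mulS (mulS (reflectS X) X) (mulS (reflectS T) T) (k ℕ.+ k)  ≡⟨ mulS-congˡ (mulS (reflectS T) T) (reflectS-cayleyProdS-inverse x) (k ℕ.+ k) ⟩
    mulS oneS (mulS (reflectS T) T) (k ℕ.+ k)                   ≡⟨ mulS-identityˡ (mulS (reflectS T) T) (k ℕ.+ k) ⟩
    mulS (reflectS T) T (k ℕ.+ k)                               ≡⟨ mulS-top k k {reflectS T} {T} reflected-degree (tPoly-degree k t) ⟩
    sgn k * T k * T k                                           ∎
    where
    open ≡-Reasoning
    X = cayleyProdS x
    T = tPoly k t
    reflected-degree : DegreeAtMost k (reflectS T)
    reflected-degree a = trans (cong (sgn (suc (k ℕ.+ a)) *_) (tPoly-degree k t a)) (*-zeroʳ (sgn (suc (k ℕ.+ a))))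

  twice-Pk : ∀ M (x : Fin (suc M) → ℚ) → Injective _≡_ _≡_ x → ∀ k t →
    two * Pk M k t x ≡ genS k t x k - sgn (suc M) * tPoly k t k
  twice-Pk M x x-inj k t = begin
    two * Pk M k t x
      ≡⟨ cong (two *_) (Pk≡weightedSum M k t x) ⟩
    two * ∑[ i < suc M ] (facPow t (x i) k * weight x i)
      ≡⟨ cong (two *_) (sum-cong-≗ {suc M} term) ⟩
    two * ∑[ i < suc M ] mulS T (λ j → weight x i * pow (x i) j) k
      ≡⟨ cong (two *_) (mulS-∑ʳ T (λ i j → weight x i * pow (x i) j) k) ⟨
    two * mulS T (λ j → ∑[ i < suc M ] (weight x i * pow (x i) j)) k
      ≡⟨ mulS-*ʳ two T (λ j → ∑[ i < suc M ] (weight x i * pow (x i) j)) k ⟨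
    mulS T (λ j → two * ∑[ i < suc M ] (weight x i * pow (x i) j)) k
      ≡⟨ mulS-congʳ T coefficient k ⟩
    mulS T (λ j → cayleyProdS x j + (- sgn (suc M)) * oneS j) k
      ≡⟨ mulS-+ʳ T (cayleyProdS x) (λ j → (- sgn (suc M)) * oneS j) k ⟩
    mulS T (cayleyProdS x) k + mulS T (λ j → (- sgn (suc M)) * oneS j) k
      ≡⟨ cong₂ _+_ (mulS-comm T (cayleyProdS x) k) (trans (mulS-*ʳ (- sgn (suc M)) T oneS k) (cong ((- sgn (suc M)) *_) (mulS-identityʳ T k))) ⟩
    genS k t x k + (- sgn (suc M)) * T k
      ≡⟨ solve 3 (λ g σ T → g :+ (:- σ) :* T := g :- σ :* T) refl (genS k t x k) (sgn (suc M)) (T k) ⟩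
    genS k t x k - sgn (suc M) * T k
      ∎
    where
    open ≡-Reasoning
    T = tPoly k t
    term : ∀ i → facPow t (x i) k * weight x i ≡ mulS T (λ j → weight x i * pow (x i) j) k
    term i = begin
      facPow t (x i) k * weight x i                  ≡⟨ cong (_* weight x i) (facPow≡coeff k t (x i)) ⟩
      mulS (geomS (x i)) T k * weight x i            ≡⟨ *-comm (mulS (geomS (x i)) T k) (weight x i) ⟩
      weight x i * mulS (geomS (x i)) T k            ≡⟨ cong (weight x i *_) (mulS-comm (geomS (x i)) T k) ⟩
      weight x i * mulS T (geomS (x i)) k            ≡⟨ mulS-*ʳ (weight x i) T (geomS (x i)) k ⟨
      mulS T (λ j → weight x i * pow (x i) j) k      ∎
    coefficient : ∀ j → two * ∑[ i < suc M ] (weight x i * pow (x i) j) ≡ cayleyProdS x j + (- sgn (suc M)) * oneS j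
    coefficient j = begin
      two * ∑[ i < suc M ] (weight x i * pow (x i) j)
        ≡⟨ cong (two *_) (sum-cong-≗ {suc M} (λ i → *-comm (weight x i) (pow (x i) j))) ⟩
      two * ∑[ i < suc M ] (pow (x i) j * weight x i)
        ≡⟨ solve 3 (λ S σ o → con two :* S := (con two :* S :+ σ :* o) :+ (:- σ) :* o) refl (∑[ i < suc M ] (pow (x i) j * weight x i)) (sgn (suc M)) (oneS j) ⟩
      two * ∑[ i < suc M ] (pow (x i) j * weight x i) + sgn (suc M) * oneS j + (- sgn (suc M)) * oneS j
        ≡⟨ cong (_+ (- sgn (suc M)) * oneS j) (cayleyProdS-coeff x x-inj j) ⟨
      cayleyProdS x j + (- sgn (suc M)) * oneS j
        ∎

  A7-algebra : ∀ s E P Q G₂ → s * s ≡ 1ℚ →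
    s * (s * E) * (s * E) ≡ s * (two * P + s * E) * (two * P + s * E) + two * s * (Q + s * G₂) →
    P * P + s * E * P + fromℕ 2 * (½ * ½ * Q) + s * (½ * G₂) ≡ 0ℚ
  A7-algebra s E P Q G₂ s²≡1 L≡R = begin
    lhs                          ≡⟨ *-identityʳ lhs ⟨
    lhs * 1ℚ                     ≡⟨ cong (lhs *_) s²≡1 ⟨
    lhs * (s * s)                ≡⟨ solve 5 (λ s E P Q G → (P :* P :+ s :* E :* P :+ con (fromℕ 2) :* (con ½ :* con ½ :* Q) :+ s :* (con ½ :* G)) :* (s :* s)
                                     := con ½ :* con ½ :* s :* ((s :* (con two :* P :+ s :* E) :* (con two :* P :+ s :* E) :+ con two :* s :* (Q :+ s :* G))
                                                               :- s :* (s :* E) :* (s :* E))) refl s E P Q G₂ ⟩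
    ½ * ½ * s * (R - L)          ≡⟨ cong (λ v → ½ * ½ * s * (v - L)) L≡R ⟨
    ½ * ½ * s * (L - L)          ≡⟨ solve 2 (λ s L → con ½ :* con ½ :* s :* (L :- L) := con 0ℚ) refl s L ⟩
    0ℚ                           ∎
    where
    open ≡-Reasoning
    lhs = P * P + s * E * P + fromℕ 2 * (½ * ½ * Q) + s * (½ * G₂)
    L = s * (s * E) * (s * E)
    R = s * (two * P + s * E) * (two * P + s * E) + two * s * (Q + s * G₂)

  module _ (m k′ : ℕ) (t : ℕ → ℚ) (x : Fin (suc (suc (2 ℕ.* m))) → ℚ) where
    private
      M k : ℕ
      M = suc (2 ℕ.* m)
      k = suc k′
      G : Series
      G = genS k t x
      P E Q : ℚ
      P = Pk M k t x
      E = esym t k k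
      Q = sumUpTo k′ (crossTerm G k)

    lhsA7-expand : lhsA7 M k t x ≡ P * P + sgn k * E * P + fromℕ 2 * (½ * ½ * Q) + sgn k * (½ * G (k ℕ.+ k))
    lhsA7-expand = cong (λ v → P * P + sgn k * E * P + fromℕ 2 * v + sgn k * (½ * G (k ℕ.+ k))) (begin
      sumL (map f (map suc (upTo k′)))              ≡⟨ cong sumL (List.map-∘ {g = f} {f = suc} (upTo k′)) ⟨
      sumL (map (f ∘ suc) (upTo k′))                ≡⟨ sumL-map-upTo k′ (f ∘ suc) ⟩
      sumUpTo k′ (f ∘ suc)                          ≡⟨ sum-cong-≗ {k′} (λ i → halves (toℕ i)) ⟩
      sumUpTo k′ (λ j → ½ * ½ * crossTerm G k j)    ≡⟨ ∑-*ˡ {k′} (½ * ½) (crossTerm G k ∘ toℕ) ⟩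
      ½ * ½ * Q                                     ∎)
      where
      open ≡-Reasoning
      f : ℕ → ℚ
      f i = sgn i * Pkup k (k ∸ i) t x * Pkup k (k ℕ.+ i) t x
      halves : ∀ j → f (suc j) ≡ ½ * ½ * crossTerm G k j
      halves j = solve 4 (λ s a b h → s :* (h :* a) :* (h :* b) := h :* h :* (s :* a :* b)) refl
        (sgn (suc j)) (G (k ∸ suc j)) (G (k ℕ.+ suc j)) ½

    reflected-square : sgn k * tPoly k t k * tPoly k t k ≡ sgn k * G k * G k + two * sgn k * (Q + sgn k * G (k ℕ.+ k))
    reflected-square = begin
      sgn k * tPoly k t k * tPoly k t k                             ≡⟨ genS-reflected-square k t x ⟨
      mulS (reflectS G) G (k ℕ.+ k)                                 ≡⟨ reflectS-mulS-middle G k ⟩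
      sgn k * G k * G k + two * sgn k * sumUpTo k (crossTerm G k)   ≡⟨ cong (λ v → sgn k * G k * G k + two * sgn k * v) (sumUpTo-snoc k′ (crossTerm G k)) ⟩
      sgn k * G k * G k + two * sgn k * (Q + crossTerm G k k′)      ≡⟨ cong (λ v → sgn k * G k * G k + two * sgn k * (Q + v)) last-term ⟩
      sgn k * G k * G k + two * sgn k * (Q + sgn k * G (k ℕ.+ k))   ∎
      where
      open ≡-Reasoning
      last-term : crossTerm G k k′ ≡ sgn k * G (k ℕ.+ k)
      last-term = begin
        sgn k * G (k ∸ k) * G (k ℕ.+ k)     ≡⟨ cong (λ v → sgn k * G v * G (k ℕ.+ k)) (ℕ.n∸n≡0 k) ⟩
        sgn k * G 0 * G (k ℕ.+ k)           ≡⟨ cong (λ v → sgn k * v * G (k ℕ.+ k)) (genS-0 k t x) ⟩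
        sgn k * 1ℚ * G (k ℕ.+ k)            ≡⟨ cong (_* G (k ℕ.+ k)) (*-identityʳ (sgn k)) ⟩
        sgn k * G (k ℕ.+ k)                 ∎

    reflected-square-in-Pk : Injective _≡_ _≡_ x →
      sgn k * (sgn k * E) * (sgn k * E) ≡
      sgn k * (two * P + sgn k * E) * (two * P + sgn k * E) + two * sgn k * (Q + sgn k * G (k ℕ.+ k))
    reflected-square-in-Pk x-inj = begin
      sgn k * (sgn k * E) * (sgn k * E)
        ≡⟨ cong (λ v → sgn k * v * v) (tPoly-top k t) ⟨
      sgn k * tPoly k t k * tPoly k t k
        ≡⟨ reflected-square ⟩
      sgn k * G k * G k + two * sgn k * (Q + sgn k * G (k ℕ.+ k))
        ≡⟨ cong (λ v → sgn k * v * v + two * sgn k * (Q + sgn k * G (k ℕ.+ k))) G-k ⟩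
      sgn k * (two * P + sgn k * E) * (two * P + sgn k * E) + two * sgn k * (Q + sgn k * G (k ℕ.+ k))
        ∎
      where
      open ≡-Reasoning
      sgn-N : sgn (suc M) ≡ 1ℚ
      sgn-N = trans (solve 1 (λ s → :- (:- s) := s) refl (sgn (2 ℕ.* m))) (sgn-even m)
      G-k : G k ≡ two * P + sgn k * E
      G-k = begin
        G k                                              ≡⟨ solve 2 (λ g T → g := (g :- con 1ℚ :* T) :+ T) refl (G k) (tPoly k t k) ⟩
        G k - 1ℚ * tPoly k t k + tPoly k t k             ≡⟨ cong₂ (λ σ v → G k - σ * tPoly k t k + v) (sym sgn-N) (tPoly-top k t) ⟩
        G k - sgn (suc M) * tPoly k t k + sgn k * E      ≡⟨ cong (_+ sgn k * E) (twice-Pk M x x-inj k t) ⟨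
        two * P + sgn k * E                              ∎

    lhsA7≡0 : Injective _≡_ _≡_ x → lhsA7 M k t x ≡ 0ℚ
    lhsA7≡0 x-inj = begin
      lhsA7 M k t x
        ≡⟨ lhsA7-expand ⟩
      P * P + sgn k * E * P + fromℕ 2 * (½ * ½ * Q) + sgn k * (½ * G (k ℕ.+ k))
        ≡⟨ A7-algebra (sgn k) E P Q (G (k ℕ.+ k)) (sgn*sgn≡1 k) (reflected-square-in-Pk x-inj) ⟩
      0ℚ
        ∎
      where open ≡-Reasoning

open import Defs
open import Data.Nat using (ℕ; suc; _≤_; _*_)
open import Data.Fin using (Fin)
open import Data.Rational using (ℚ; 0ℚ)
open import Function.Definitions using (Injective)
open import Relation.Binary.PropositionalEquality using (_≡_)
open QuadraticRelation using (lhsA7≡0)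

propositionA7 : (n k : ℕ) → 1 ≤ n → 1 ≤ k → k ≤ n →
    (m : ℕ) (x : Fin (suc (suc (2 * m))) → ℚ) → Injective _≡_ _≡_ x →
    (t : ℕ → ℚ) → lhsA7 (suc (2 * m)) k t x ≡ 0ℚ
propositionA7 _ 0        _ () _ _ _ _     _
propositionA7 _ (suc k′) _ _  _ m x x-inj t = lhsA7≡0 m k′ t x x-inj
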